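{- Let $(s,\gamma,w)$ be a weighted labelled chain. Then (1) $\psi(K_{(s,\gamma,w)})=(-1)^{w(s)-|s|}K_{(s,\gamma^*,w)}$; (2) $\rho(K_{(s,\gamma,w)})=K_{(s^*,\gamma^*,w)}$; (3) $\omega(K_{(s,\gamma,w)})=(-1)^{w(s)-|s|}K_{(s^*,\gamma,w)}$.
   Context: Let $\mathbb N=\{1,2,\dots\}$. A labelling of a finite poset $P$ is an injective map $\gamma$ from $P$ to a chain $c$; the dual labelling $\gamma^*:P\to c^*$ has the same values, $c^*$ being $c$ with reversed order. For a poset $P$, $P^*$ is the dual poset (same set, reversed order). A weight function is $w:P\to\mathbb N$. A $(P,\gamma)$-partition is $f:P\to\mathbb N$ with, for all $p<q$ in $P$, $f(p)\le f(q)$ and $f(p)=f(q)\Rightarrow\gamma(p)<\gamma(q)$. $K_{(P,\gamma,w)}=\sum_f\prod_{u\in P}x_{f(u)}^{w(u)}$ over all $(P,\gamma)$-partitions. A weighted labelled chain has $P=s$ a finite chain; $|s|$ is its number of elements and $w(s)=\sum_{u\in s}w(u)$. For $\alpha\vDash n$, $\mathrm{set}(\alpha)=\{\alpha_1,\alpha_1+\alpha_2,\dots\}\subseteq[n-1]$ with inverse $\mathrm{comp}$; $\alpha^r$ is the reversal, $\alpha^c=\mathrm{comp}([n-1]\setminus\mathrm{set}(\alpha))$, $\alpha^t=(\alpha^r)^c$. $F_\alpha=\sum x_{i_1}\cdots x_{i_n}$ over $i_1\le\dots\le i_n$ with $i_j<i_{j+1}$ whenever $j\in\mathrm{set}(\alpha)$.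 $\psi,\rho,\omega:\mathrm{QSym}\to\mathrm{QSym}$ are the linear maps with $\psi(F_\alpha)=F_{\alpha^c}$, $\rho(F_\alpha)=F_{\alpha^r}$, $\omega(F_\alpha)=F_{\alpha^t}$. -}

module Defs where

open import Data.Bool using (Bool; true; false; _∧_; _∨_; not; if_then_else_)
open import Data.Nat using (ℕ; zero; suc; _+_; _∸_; _≤ᵇ_; _<ᵇ_; _≡ᵇ_)
open import Data.Fin using (Fin; toℕ)
open import Data.Vec using (Vec; []; _∷_; lookup; tabulate)
open import Data.List using (List; []; _∷_; _++_; [_]; map; concatMap; allFin; reverse; applyUpTo; filterᵇ; foldr)
open import Data.Integer using (ℤ; +_; -_) renaming (_+_ to _+ℤ_; _*_ to _*ℤ_; _^_ to _^ℤ_)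
open import Data.Product using (Σ; _×_; _,_; proj₁; proj₂)
open import Data.List.Relation.Unary.All using (All)
open import Relation.Binary.PropositionalEquality using (_≡_)
import Data.Nat as N
import Data.Vec as V

-- Formal power series in the variables x₁, x₂, … with ℤ coefficients.
-- A monomial x₁^{e₁} ⋯ x_m^{e_m} is given by m and e : Vec ℕ m
-- (the same monomial may be written with trailing zero exponents; all
-- series below assign the same coefficient to every such representation).

Series : Set
Series = (m : ℕ) → Vec ℕ m → ℤ

infix 4 _≈ₛ_
_≈ₛ_ : Series → Series → Set
A ≈ₛ B = ∀ m (e : Vec ℕ m) → A m e ≡ B m e

-- all maps Fin k → Fin m, as vectors
allVec : ∀ k m → List (Vec (Fin m) k)
allVec zero    m = [ [] ]
allVec (suc k) m = concatMap (λ v → map (_∷ v) (allFin m)) (allVec k m)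

allᵇ : {A : Set} → (A → Bool) → List A → Bool
allᵇ P []       = true
allᵇ P (x ∷ xs) = P x ∧ allᵇ P xs

anyᵇ : {A : Set} → (A → Bool) → List A → Bool
anyᵇ P []       = false
anyᵇ P (x ∷ xs) = P x ∨ anyᵇ P xs

countᵇ : {A : Set} → (A → Bool) → List A → ℕ
countᵇ P []       = 0
countᵇ P (x ∷ xs) = (if P x then 1 else 0) + countᵇ P xs

vecEqᵇ : ∀ {m} → Vec ℕ m → Vec ℕ m → Bool
vecEqᵇ []       []       = true
vecEqᵇ (a ∷ as) (b ∷ bs) = (a ≡ᵇ b) ∧ vecEqᵇ as bs

sumFin : ∀ k → (Fin k → ℕ) → ℕ
sumFin k g = foldr _+_ 0 (map g (allFin k))

-- exponent vector (in x₁..x_m) of ∏_u x_{f(u)}^{w(u)}, where the value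
-- f(u) ∈ {1..m} is encoded by i : Fin m as toℕ i + 1
monomial : ∀ {k} m → (Fin k → Fin m) → (Fin k → ℕ) → Vec ℕ m
monomial {k} m f w =
  tabulate (λ i → sumFin k (λ u → if toℕ (f u) ≡ᵇ toℕ i then w u else 0))

-- Weighted labelled posets on the set Fin k.
-- The strict order of the poset is given as a Boolean relation ltP;
-- the labelling γ takes values in a chain whose strict order is ltC.

chainLt : ∀ {k} → Fin k → Fin k → Bool
chainLt p q = toℕ p <ᵇ toℕ q

labelLt : ℕ → ℕ → Bool
labelLt a b = a <ᵇ b

-- dual of a strict order (reversed order): used both for s* and c*
dualᵇ : {A : Set} → (A → A → Bool) → A → A → Bool
dualᵇ R a b = R b a

isPartitionᵇ : ∀ {k} → (Fin k → Fin k → Bool) → (ℕ → ℕ → Bool)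
             → (Fin k → ℕ) → (Fin k → ℕ) → Bool
isPartitionᵇ {k} ltP ltC γ f =
  allᵇ (λ p → allᵇ (λ q →
        not (ltP p q) ∨ ((f p ≤ᵇ f q) ∧ (not (f p ≡ᵇ f q) ∨ ltC (γ p) (γ q))))
      (allFin k)) (allFin k)

-- Coefficient of x^e (e over x₁..x_m) = number of (P,γ)-partitions f with
-- ∏ x_{f(u)}^{w(u)} = x^e.  Since w(u) ≥ 1 such f take values in {1..m}.
K : ∀ k → (Fin k → Fin k → Bool) → (ℕ → ℕ → Bool)
  → (Fin k → ℕ) → (Fin k → ℕ) → Series
K k ltP ltC γ w m e =
  + countᵇ (λ v → isPartitionᵇ ltP ltC γ (λ u → suc (toℕ (lookup v u)))
                  ∧ vecEqᵇ (monomial m (lookup v) w) e)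
           (allVec k m)

sumL : List ℕ → ℕ
sumL = foldr _+_ 0

setC : List ℕ → List ℕ
setC []           = []
setC (a ∷ [])     = []
setC (a ∷ b ∷ as) = a ∷ map (λ x → a + x) (setC (b ∷ as))

memᵇ : ℕ → List ℕ → Bool
memᵇ j S = anyᵇ (λ x → j ≡ᵇ x) S

-- comp n S for S ⊆ [n-1] increasing: consecutive differences of 0,S,n
diffs : ℕ → List ℕ → List ℕ
diffs prev []       = []
diffs prev (x ∷ xs) = (x ∸ prev) ∷ diffs x xs

compC : ℕ → List ℕ → List ℕ
compC zero    S = []
compC (suc n) S = diffs 0 (S ++ [ suc n ])

range1 : ℕ → List ℕ
range1 n = applyUpTo suc (n ∸ 1)

revC : List ℕ → List ℕ
revC = reverse

cC : List ℕ → List ℕ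
cC α = compC (sumL α) (filterᵇ (λ j → not (memᵇ j (setC α))) (range1 (sumL α)))

tC : List ℕ → List ℕ
tC α = cC (revC α)

-- weakly increasing sequence i₁ ≤ ⋯ ≤ iₙ (list), strictly increasing at
-- positions j ∈ S; j is the (1-based) position of the head
seqOKᵇ : List ℕ → ℕ → List ℕ → Bool
seqOKᵇ S j (a ∷ b ∷ rest) =
  (if memᵇ j S then a <ᵇ b else a ≤ᵇ b) ∧ seqOKᵇ S (suc j) (b ∷ rest)
seqOKᵇ S j _ = true

vecToList : ∀ {A : Set} {n} → Vec A n → List A
vecToList []       = []
vecToList (x ∷ xs) = x ∷ vecToList xs

F : List ℕ → Series
F α m e =
  + countᵇ (λ v → seqOKᵇ (setC α) 1 (vecToList (V.map toℕ v))
                  ∧ vecEqᵇ (monomial m (lookup v) (λ _ → 1)) e)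
           (allVec (sumL α) m)

linF : List (ℤ × List ℕ) → Series
linF []             m e = + 0
linF ((c , α) ∷ L) m e = (c *ℤ F α m e) +ℤ linF L m e

onBasis : (List ℕ → List ℕ) → List (ℤ × List ℕ) → List (ℤ × List ℕ)
onBasis φ = map (λ p → proj₁ p , φ (proj₂ p))

scale : ℤ → Series → Series
scale c A m e = c *ℤ A m e

sign : ℕ → ℤ
sign n = (- (+ 1)) ^ℤ n

-- "Φ(A) = B" for Φ ∈ {ψ, ρ, ω}: the linear map on QSym given on the
-- fundamental basis by F_α ↦ F_{φ α}.  Since {F_α} is a basis of QSym,
-- this holds iff A has an F-expansion Σ c_α F_α (with α compositions)
-- such that B = Σ c_α F_{φ α}.

IsComposition : List ℕ → Set
IsComposition α = All (λ a → 1 N.≤ a) α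

MapsTo : (List ℕ → List ℕ) → Series → Series → Set
MapsTo φ A B =
  Σ (List (ℤ × List ℕ)) λ L →
    All (λ p → IsComposition (proj₂ p)) L
    × (A ≈ₛ linF L) × (B ≈ₛ linF (onBasis φ L))

ψ-maps ρ-maps ω-maps : Series → Series → Set
ψ-maps = MapsTo cC
ρ-maps = MapsTo revC
ω-maps = MapsTo tC

{-# OPTIONS --safe #-}
module Submission where

-- A (s,γ)-partition of a chain u₁ < ⋯ < u_k is a sequence f(u₁) ≤ ⋯ ≤ f(u_k) that must increase
-- strictly wherever the labels descend, and a weight w(u) asks for w(u) − 1 further copies of
-- x_{f(u)}, i.e. for w(u) − 1 additional consecutive equal values.  So K counts sequences governed
-- by a word of weak, strict and equal steps, with w(s) − |s| equal steps.  Resolving every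
-- equality as [a ≤ b] − [a < b] writes K as a signed sum of fundamental quasisymmetric functions
-- F_α, one for each resolved word, α having its descent set at the strict steps.
-- Complementing α swaps weak and strict steps: on the unresolved word this is the word of
-- (s, γ*) (γ is injective, so every step between labels flips), while each of the w(s) − |s|
-- resolved equalities changes sign.  Reversing α reverses the word; reading partitions of s*
-- backwards with values reflected (xᵢ ↦ x_{m+1−i}) shows this is the word of (s*, γ*).
-- Finally ω = ψ ∘ ρ.

open import Data.Bool using (Bool; true; false; T; not; _∧_; _∨_; if_then_else_)
open import Data.Bool.Properties using (T-∧; ∧-comm; ∧-assoc; ∧-identityʳ; ∨-zeroʳ; ∨-identityʳ)
open import Data.Nat using (ℕ; zero; suc; _+_; _∸_; _≤_; _<_; z≤n; s≤s; _≤ᵇ_; _<ᵇ_; _≡ᵇ_)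
open import Data.Nat.Properties
open import Algebra.Properties.CommutativeSemigroup +-commutativeSemigroup using (x∙yz≈y∙xz)
open import Data.Fin using (Fin; toℕ; opposite) renaming (zero to fzero; suc to fsuc)
open import Data.Fin.Properties using (toℕ-injective; opposite-prop; opposite-involutive)
open import Data.Integer using (ℤ; +_; -_; 0ℤ; 1ℤ)
  renaming (_+_ to _+ℤ_; _*_ to _*ℤ_; _-_ to _-ℤ_)
import Data.Integer.Properties as ℤ
open import Data.Integer.Tactic.RingSolver using (solve-∀)
open import Data.List as List
  using (List; []; _∷_; map; length; allFin; filterᵇ; reverse; _++_; [_]; applyUpTo; replicate; drop)
open import Data.List.Properties as Listₚ
  using ( length-map; map-∘; map-cong; map-id; map-id-local; map-tabulate; map-++; map-replicate
        ; unfold-reverse; reverse-map; reverse-involutive; length-reverse; ++-assoc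
        ; length-++; length-replicate; length-drop)
open import Data.List.Membership.Propositional using (_∈_)
open import Data.List.Membership.Propositional.Properties
  using (∈-map⁺; ∈-map⁻; ∈-filter⁺; ∈-filter⁻; ∈-concat⁺′; ∈-allFin)
open import Data.List.Membership.Propositional.Properties.WithK using (unique∧set⇒bag)
open import Data.List.Relation.Unary.Any using (here; there)
open import Data.List.Relation.Unary.All as All using (All; []; _∷_)
import Data.List.Relation.Unary.All.Properties as Allₚ
open import Data.List.Relation.Unary.AllPairs as AllPairs using (_∷_)
import Data.List.Relation.Unary.AllPairs.Properties as AllPairsₚ
open import Data.List.Relation.Unary.Unique.Propositional using (Unique)
import Data.List.Relation.Unary.Unique.Propositional.Properties as Uniqueₚ
open import Data.List.Relation.Binary.BagAndSetEquality using (∼bag⇒↭)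
open import Data.List.Relation.Binary.Permutation.Propositional.Properties using (↭-length)
open import Data.Vec as Vec using (Vec; []; _∷_; toList; fromList; lookup; tabulate)
import Data.List.Properties as Listₚ
open import Data.Vec.Properties
  using ( ∷-injective; toList-injective; toList∘fromList; length-toList; toList-map; cast-is-id
        ; tabulate-cong; lookup∘tabulate; tabulate∘lookup; lookup-map)
open import Data.Empty using (⊥; ⊥-elim)
open import Data.Sum using (inj₁; inj₂)
open import Data.Unit using (⊤; tt)
open import Data.Product using (_×_; _,_; proj₁; proj₂)
open import Function using (_∘_)
open import Function.Definitions using (Injective)
open import Function.Bundles using (mk⇔; Equivalence)
open import Relation.Nullary.Decidable using (T?)
open import Relation.Binary.PropositionalEquality hiding ([_])
open ≡-Reasoning

open import Defs

private variable
  A B : Set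

-- Counting by bijections

countᵇ≡length∘filterᵇ : (P : A → Bool) (xs : List A) → countᵇ P xs ≡ length (filterᵇ P xs)
countᵇ≡length∘filterᵇ P [] = refl
countᵇ≡length∘filterᵇ P (x ∷ xs) with P x
... | true  = cong suc (countᵇ≡length∘filterᵇ P xs)
... | false = countᵇ≡length∘filterᵇ P xs

countᵇ-cong : {P Q : A → Bool} (xs : List A) → (∀ x → P x ≡ Q x) → countᵇ P xs ≡ countᵇ Q xs
countᵇ-cong [] P≗Q = refl
countᵇ-cong (x ∷ xs) P≗Q =
  cong₂ _+_ (cong (λ b → if b then 1 else 0) (P≗Q x)) (countᵇ-cong xs P≗Q)

countᵇ-map : (P : B → Bool) (f : A → B) (xs : List A) → countᵇ P (map f xs) ≡ countᵇ (P ∘ f) xs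
countᵇ-map P f [] = refl
countᵇ-map P f (x ∷ xs) = cong (λ c → (if P (f x) then 1 else 0) + c) (countᵇ-map P f xs)

countᵇ-bijection : {xs : List A} {ys : List B} → Unique xs → Unique ys →
  (P : A → Bool) (Q : B → Bool) (f : A → B) (g : B → A) →
  (∀ {x} → x ∈ xs → T (P x) → f x ∈ ys × T (Q (f x)) × g (f x) ≡ x) →
  (∀ {y} → y ∈ ys → T (Q y) → g y ∈ xs × T (P (g y)) × f (g y) ≡ y) →
  countᵇ P xs ≡ countᵇ Q ys
countᵇ-bijection {A = A} {B = B} {xs = xs} {ys} xs! ys! P Q f g to from = begin
  countᵇ P xs         ≡⟨ countᵇ≡length∘filterᵇ P xs ⟩
  length Pxs          ≡⟨ length-map f Pxs ⟨
  length (map f Pxs)  ≡⟨ ↭-length (∼bag⇒↭ (unique∧set⇒bag fPxs! Qys! (mk⇔ image⊆ image⊇))) ⟩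
  length Qys          ≡⟨ countᵇ≡length∘filterᵇ Q ys ⟨
  countᵇ Q ys         ∎
  where
  Pxs : List A
  Pxs = filterᵇ P xs
  Qys : List B
  Qys = filterᵇ Q ys
  retract : map g (map f Pxs) ≡ Pxs
  retract = trans (sym (map-∘ Pxs)) (map-id-local (All.tabulate λ x∈ →
    let x∈xs , Px = ∈-filter⁻ (T? ∘ P) x∈ in proj₂ (proj₂ (to x∈xs Px))))
  fPxs! : Unique (map f Pxs)
  fPxs! = Uniqueₚ.map⁻ (subst Unique (sym retract) (Uniqueₚ.filter⁺ (T? ∘ P) xs!))
  Qys! : Unique Qys
  Qys! = Uniqueₚ.filter⁺ (T? ∘ Q) ys!
  image⊆ : ∀ {y} → y ∈ map f Pxs → y ∈ Qys
  image⊆ y∈ with ∈-map⁻ f y∈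
  ... | x , x∈ , refl = let x∈xs , Px = ∈-filter⁻ (T? ∘ P) x∈ ; fx∈ys , Qfx , _ = to x∈xs Px in
    ∈-filter⁺ (T? ∘ Q) fx∈ys Qfx
  image⊇ : ∀ {y} → y ∈ Qys → y ∈ map f Pxs
  image⊇ {y} y∈ = let y∈ys , Qy = ∈-filter⁻ (T? ∘ Q) y∈ ; gy∈xs , Pgy , fgy≡y = from y∈ys Qy in
    subst (_∈ map f Pxs) fgy≡y (∈-map⁺ f (∈-filter⁺ (T? ∘ P) gy∈xs Pgy))

allVec-complete : ∀ k m (v : Vec (Fin m) k) → v ∈ allVec k m
allVec-complete zero m [] = here refl
allVec-complete (suc k) m (x ∷ v) =
  ∈-concat⁺′ (∈-map⁺ (_∷ v) (∈-allFin x))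
             (∈-map⁺ (λ v → map (_∷ v) (allFin m)) (allVec-complete k m v))

allVec-unique : ∀ k m → Unique (allVec k m)
allVec-unique zero m = [] ∷ AllPairs.[]
allVec-unique (suc k) m =
  Uniqueₚ.concat⁺ (All.tabulate rows!) (AllPairsₚ.map⁺ (AllPairs.map rowsDisjoint (allVec-unique k m)))
  where
  rows! : ∀ {row} → row ∈ map (λ v → map (_∷ v) (allFin m)) (allVec k m) → Unique row
  rows! row∈ with ∈-map⁻ _ row∈
  ... | v , _ , refl = Uniqueₚ.map⁺ (proj₁ ∘ ∷-injective) (Uniqueₚ.allFin⁺ m)
  rowsDisjoint : ∀ {v w} → v ≢ w → ∀ {z} → z ∈ map (_∷ v) (allFin m) × z ∈ map (_∷ w) (allFin m) → ⊥
  rowsDisjoint v≢w (z∈v , z∈w) with ∈-map⁻ _ z∈v | ∈-map⁻ _ z∈w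
  ... | _ , _ , refl | _ , _ , e = v≢w (proj₂ (∷-injective e))

allLists : ℕ → (m : ℕ) → List (List (Fin m))
allLists n m = map toList (allVec n m)

∈-allLists⁺ : ∀ {n m} (l : List (Fin m)) → length l ≡ n → l ∈ allLists n m
∈-allLists⁺ {m = m} l refl =
  subst (_∈ allLists (length l) m) (toList∘fromList l)
        (∈-map⁺ toList (allVec-complete (length l) m (fromList l)))

∈-allLists⁻ : ∀ {n m} {l : List (Fin m)} → l ∈ allLists n m → length l ≡ n
∈-allLists⁻ l∈ with ∈-map⁻ toList l∈
... | v , _ , refl = length-toList v

allLists-unique : ∀ n m → Unique (allLists n m)
allLists-unique n m = Uniqueₚ.map⁺ (λ {v} {w} e → trans (sym (cast-is-id refl v)) (toList-injective refl v w e))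
  (allVec-unique n m)

vecToList≡toList : ∀ {n} (v : Vec A n) → vecToList v ≡ toList v
vecToList≡toList []      = refl
vecToList≡toList (x ∷ v) = cong (x ∷_) (vecToList≡toList v)

-- Words of steps and their compositions

data Step : Set where
  weak strict equal : Step

isStrict : Step → Bool
isStrict strict = true
isStrict _      = false

flipStep : Step → Step
flipStep weak   = strict
flipStep strict = weak
flipStep equal  = equal

EqualityFree : List Step → Set
EqualityFree = All (_≢ equal)

flipStep-equalityFree : ∀ {rs} → EqualityFree rs → EqualityFree (map flipStep rs)
flipStep-equalityFree [] = []
flipStep-equalityFree {weak ∷ _}   (_ ∷ ne) = (λ ()) ∷ flipStep-equalityFree ne
flipStep-equalityFree {strict ∷ _} (_ ∷ ne) = (λ ()) ∷ flipStep-equalityFree ne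
flipStep-equalityFree {equal ∷ _}  (r≢ ∷ _) = ⊥-elim (r≢ refl)

reverse-equalityFree : ∀ {rs} → EqualityFree rs → EqualityFree (reverse rs)
reverse-equalityFree {[]}     []       = []
reverse-equalityFree {r ∷ rs} (p ∷ ne) =
  subst EqualityFree (sym (unfold-reverse r rs)) (Allₚ.++⁺ (reverse-equalityFree ne) (p ∷ []))

sucHead : List ℕ → List ℕ
sucHead []       = []
sucHead (a ∷ as) = suc a ∷ as

-- The composition α of length rs + 1 with set(α) the positions of the strict steps of rs.
runs : List Step → List ℕ
runs []            = 1 ∷ []
runs (strict ∷ rs) = 1 ∷ runs rs
runs (weak ∷ rs)   = sucHead (runs rs)
runs (equal ∷ rs)  = sucHead (runs rs)

runs≢[] : ∀ rs → runs rs ≢ []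
runs≢[] []            ()
runs≢[] (strict ∷ rs) ()
runs≢[] (weak ∷ rs)   with runs rs | runs≢[] rs
... | [] | ne = ⊥-elim (ne refl)
... | _ ∷ _ | _ = λ ()
runs≢[] (equal ∷ rs)  with runs rs | runs≢[] rs
... | [] | ne = ⊥-elim (ne refl)
... | _ ∷ _ | _ = λ ()

sucHead-composition : ∀ {α} → IsComposition α → IsComposition (sucHead α)
sucHead-composition []      = []
sucHead-composition (_ ∷ p) = s≤s z≤n ∷ p

runs-composition : ∀ rs → IsComposition (runs rs)
runs-composition []            = s≤s z≤n ∷ []
runs-composition (strict ∷ rs) = s≤s z≤n ∷ runs-composition rs
runs-composition (weak ∷ rs)   = sucHead-composition (runs-composition rs)
runs-composition (equal ∷ rs)  = sucHead-composition (runs-composition rs)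

sumL-sucHead : ∀ α → α ≢ [] → sumL (sucHead α) ≡ suc (sumL α)
sumL-sucHead []      ne = ⊥-elim (ne refl)
sumL-sucHead (_ ∷ _) ne = refl

sumL-runs : ∀ rs → sumL (runs rs) ≡ suc (length rs)
sumL-runs []            = refl
sumL-runs (strict ∷ rs) = cong suc (sumL-runs rs)
sumL-runs (weak ∷ rs)   = trans (sumL-sucHead (runs rs) (runs≢[] rs)) (cong suc (sumL-runs rs))
sumL-runs (equal ∷ rs)  = trans (sumL-sucHead (runs rs) (runs≢[] rs)) (cong suc (sumL-runs rs))

strictPositions : ℕ → List Step → List ℕ
strictPositions j []       = []
strictPositions j (r ∷ rs) =
  if isStrict r then j ∷ strictPositions (suc j) rs else strictPositions (suc j) rs

strictPositions-suc : ∀ j rs → strictPositions (suc j) rs ≡ map suc (strictPositions j rs)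
strictPositions-suc j []            = refl
strictPositions-suc j (strict ∷ rs) = cong (suc j ∷_) (strictPositions-suc (suc j) rs)
strictPositions-suc j (weak ∷ rs)   = strictPositions-suc (suc j) rs
strictPositions-suc j (equal ∷ rs)  = strictPositions-suc (suc j) rs

strictPositions-≥ : ∀ j rs → All (j ≤_) (strictPositions j rs)
strictPositions-≥ j []            = []
strictPositions-≥ j (strict ∷ rs) = ≤-refl ∷ All.map (≤-trans (n≤1+n j)) (strictPositions-≥ (suc j) rs)
strictPositions-≥ j (weak ∷ rs)   = All.map (≤-trans (n≤1+n j)) (strictPositions-≥ (suc j) rs)
strictPositions-≥ j (equal ∷ rs)  = All.map (≤-trans (n≤1+n j)) (strictPositions-≥ (suc j) rs)

setC-sucHead : ∀ α → setC (sucHead α) ≡ map suc (setC α)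
setC-sucHead []           = refl
setC-sucHead (a ∷ [])     = refl
setC-sucHead (a ∷ b ∷ as) = cong (suc a ∷_) (map-∘ (setC (b ∷ as)))

setC-1∷ : ∀ α → α ≢ [] → setC (1 ∷ α) ≡ 1 ∷ map suc (setC α)
setC-1∷ []      ne = ⊥-elim (ne refl)
setC-1∷ (_ ∷ _) ne = refl

setC-runs : ∀ rs → setC (runs rs) ≡ strictPositions 1 rs
setC-runs []            = refl
setC-runs (strict ∷ rs) = begin
  setC (1 ∷ runs rs)                 ≡⟨ setC-1∷ (runs rs) (runs≢[] rs) ⟩
  1 ∷ map suc (setC (runs rs))       ≡⟨ cong (λ S → 1 ∷ map suc S) (setC-runs rs) ⟩
  1 ∷ map suc (strictPositions 1 rs) ≡⟨ cong (1 ∷_) (strictPositions-suc 1 rs) ⟨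
  1 ∷ strictPositions 2 rs           ∎
setC-runs (weak ∷ rs)   = trans (setC-sucHead (runs rs))
  (trans (cong (map suc) (setC-runs rs)) (sym (strictPositions-suc 1 rs)))
setC-runs (equal ∷ rs)  = trans (setC-sucHead (runs rs))
  (trans (cong (map suc) (setC-runs rs)) (sym (strictPositions-suc 1 rs)))

stepᵇ : Step → ℕ → ℕ → Bool
stepᵇ weak   a b = a ≤ᵇ b
stepᵇ strict a b = a <ᵇ b
stepᵇ equal  a b = a ≡ᵇ b

satisfiesᵇ : List Step → List ℕ → Bool
satisfiesᵇ []       l           = true
satisfiesᵇ (r ∷ rs) []          = true
satisfiesᵇ (r ∷ rs) (a ∷ [])    = true
satisfiesᵇ (r ∷ rs) (a ∷ b ∷ l) = stepᵇ r a b ∧ satisfiesᵇ rs (b ∷ l)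

Marks : (ℕ → Bool) → ℕ → List Step → Set
Marks P j []       = ⊤
Marks P j (r ∷ rs) = P j ≡ isStrict r × Marks P (suc j) rs

≡ᵇ-refl : ∀ n → (n ≡ᵇ n) ≡ true
≡ᵇ-refl zero    = refl
≡ᵇ-refl (suc n) = ≡ᵇ-refl n

memᵇ-below : ∀ i S → All (i <_) S → memᵇ i S ≡ false
memᵇ-below i []      []          = refl
memᵇ-below i (x ∷ S) (i<x ∷ i<S) with i ≡ᵇ x in i≡ᵇx
... | true  = ⊥-elim (<⇒≢ i<x (≡ᵇ⇒≡ i x (subst T (sym i≡ᵇx) tt)))
... | false = memᵇ-below i S i<S

Marks-∷ : ∀ {x} S j rs → x < j → Marks (λ i → memᵇ i S) j rs → Marks (λ i → memᵇ i (x ∷ S)) j rs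
Marks-∷ S j []       x<j _              = tt
Marks-∷ {x} S j (r ∷ rs) x<j (mark , marks) with j ≡ᵇ x in j≡ᵇx
... | true  = ⊥-elim (<⇒≢ x<j (sym (≡ᵇ⇒≡ j x (subst T (sym j≡ᵇx) tt))))
... | false = mark , Marks-∷ S (suc j) rs (≤-trans x<j (n≤1+n j)) marks

strictPositions-marks : ∀ j rs → Marks (λ i → memᵇ i (strictPositions j rs)) j rs
strictPositions-marks j []            = tt
strictPositions-marks j (strict ∷ rs) rewrite ≡ᵇ-refl j =
  refl , Marks-∷ (strictPositions (suc j) rs) (suc j) rs ≤-refl (strictPositions-marks (suc j) rs)
strictPositions-marks j (weak ∷ rs)   =
  memᵇ-below j _ (strictPositions-≥ (suc j) rs) , strictPositions-marks (suc j) rs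
strictPositions-marks j (equal ∷ rs)  =
  memᵇ-below j _ (strictPositions-≥ (suc j) rs) , strictPositions-marks (suc j) rs

seqOKᵇ≡satisfiesᵇ : ∀ {S j} rs l → EqualityFree rs → Marks (λ i → memᵇ i S) j rs →
  length l ≡ suc (length rs) → seqOKᵇ S j l ≡ satisfiesᵇ rs l
seqOKᵇ≡satisfiesᵇ [] (a ∷ []) _ _ _ = refl
seqOKᵇ≡satisfiesᵇ {S} {j} (r ∷ rs) (a ∷ b ∷ l) (r≢equal ∷ ne) (mark , marks) len =
  cong₂ _∧_ (firstStep r r≢equal mark) (seqOKᵇ≡satisfiesᵇ rs (b ∷ l) ne marks (suc-injective len))
  where
  firstStep : ∀ r → r ≢ equal → memᵇ j S ≡ isStrict r →
    (if memᵇ j S then a <ᵇ b else a ≤ᵇ b) ≡ stepᵇ r a b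
  firstStep weak   _       j∉S = cong (λ c → if c then a <ᵇ b else a ≤ᵇ b) j∉S
  firstStep strict _       j∈S = cong (λ c → if c then a <ᵇ b else a ≤ᵇ b) j∈S
  firstStep equal  r≢equal _   = ⊥-elim (r≢equal refl)

seqOKᵇ-runs : ∀ rs l → EqualityFree rs → length l ≡ suc (length rs) →
  seqOKᵇ (setC (runs rs)) 1 l ≡ satisfiesᵇ rs l
seqOKᵇ-runs rs l ne len rewrite setC-runs rs =
  seqOKᵇ≡satisfiesᵇ rs l ne (strictPositions-marks 1 rs) len

Marks-flipStep : ∀ {P} j rs → EqualityFree rs → Marks P j rs → Marks (not ∘ P) j (map flipStep rs)
Marks-flipStep j []            _              _              = tt
Marks-flipStep j (weak ∷ rs)   (_ ∷ ne)       (mark , marks) = cong not mark , Marks-flipStep (suc j) rs ne marks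
Marks-flipStep j (strict ∷ rs) (_ ∷ ne)       (mark , marks) = cong not mark , Marks-flipStep (suc j) rs ne marks
Marks-flipStep j (equal ∷ rs)  (r≢equal ∷ _)  _              = ⊥-elim (r≢equal refl)

rangeFrom : ℕ → ℕ → List ℕ
rangeFrom j zero    = []
rangeFrom j (suc n) = j ∷ rangeFrom (suc j) n

applyUpTo-shift : ∀ (f : ℕ → ℕ) j n → (∀ i → f i ≡ j + i) → applyUpTo f n ≡ rangeFrom j n
applyUpTo-shift f j zero    f≗j+ = refl
applyUpTo-shift f j (suc n) f≗j+ = cong₂ _∷_ (trans (f≗j+ 0) (+-identityʳ j))
  (applyUpTo-shift (f ∘ suc) (suc j) n (λ i → trans (f≗j+ (suc i)) (+-suc j i)))

filterᵇ-rangeFrom : ∀ P j rs → Marks P j rs → filterᵇ P (rangeFrom j (length rs)) ≡ strictPositions j rs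
filterᵇ-rangeFrom P j []       _              = refl
filterᵇ-rangeFrom P j (r ∷ rs) (mark , marks) rewrite mark with isStrict r
... | true  = cong (j ∷_) (filterᵇ-rangeFrom P (suc j) rs marks)
... | false = filterᵇ-rangeFrom P (suc j) rs marks

addToHead : ℕ → List ℕ → List ℕ
addToHead d []       = []
addToHead d (a ∷ as) = a + d ∷ as

addToHead-zero : ∀ α → addToHead 0 α ≡ α
addToHead-zero []       = refl
addToHead-zero (a ∷ as) = cong (_∷ as) (+-identityʳ a)

addToHead-suc : ∀ d α → addToHead (suc d) α ≡ addToHead d (sucHead α)
addToHead-suc d []       = refl
addToHead-suc d (a ∷ as) = cong (_∷ as) (+-suc a d)

diffs-strictPositions : ∀ rs d p →
  diffs p (strictPositions (suc (d + p)) rs ++ [ suc (d + p) + length rs ]) ≡ addToHead d (runs rs)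
diffs-strictPositions [] d p =
  cong (_∷ []) (trans (cong (_∸ p) (+-identityʳ (suc (d + p)))) (m+n∸n≡m (suc d) p))
diffs-strictPositions (strict ∷ rs) d p = cong₂ _∷_ (m+n∸n≡m (suc d) p) (begin
  diffs (suc (d + p)) (strictPositions (suc (suc (d + p))) rs ++ [ suc (d + p) + suc (length rs) ])
    ≡⟨ cong (λ x → diffs (suc (d + p)) (strictPositions (suc (suc (d + p))) rs ++ [ x ])) (+-suc (suc (d + p)) (length rs)) ⟩
  diffs (suc (d + p)) (strictPositions (suc (suc (d + p))) rs ++ [ suc (suc (d + p)) + length rs ])
    ≡⟨ diffs-strictPositions rs 0 (suc (d + p)) ⟩
  addToHead 0 (runs rs)
    ≡⟨ addToHead-zero (runs rs) ⟩
  runs rs ∎)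
diffs-strictPositions (weak ∷ rs) d p = begin
  diffs p (strictPositions (suc (suc (d + p))) rs ++ [ suc (d + p) + suc (length rs) ])
    ≡⟨ cong (λ x → diffs p (strictPositions (suc (suc (d + p))) rs ++ [ x ])) (+-suc (suc (d + p)) (length rs)) ⟩
  diffs p (strictPositions (suc (suc (d + p))) rs ++ [ suc (suc (d + p)) + length rs ])
    ≡⟨ diffs-strictPositions rs (suc d) p ⟩
  addToHead (suc d) (runs rs)
    ≡⟨ addToHead-suc d (runs rs) ⟩
  addToHead d (sucHead (runs rs)) ∎
diffs-strictPositions (equal ∷ rs) d p = begin
  diffs p (strictPositions (suc (suc (d + p))) rs ++ [ suc (d + p) + suc (length rs) ])
    ≡⟨ cong (λ x → diffs p (strictPositions (suc (suc (d + p))) rs ++ [ x ])) (+-suc (suc (d + p)) (length rs)) ⟩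
  diffs p (strictPositions (suc (suc (d + p))) rs ++ [ suc (suc (d + p)) + length rs ])
    ≡⟨ diffs-strictPositions rs (suc d) p ⟩
  addToHead (suc d) (runs rs)
    ≡⟨ addToHead-suc d (runs rs) ⟩
  addToHead d (sucHead (runs rs)) ∎

cC-runs : ∀ rs → EqualityFree rs → cC (runs rs) ≡ runs (map flipStep rs)
cC-runs rs ne = begin
  cC (runs rs)
    ≡⟨ cong₂ (λ n S → compC n (filterᵇ (λ j → not (memᵇ j S)) (range1 n))) (sumL-runs rs) (setC-runs rs) ⟩
  compC (suc n) (filterᵇ (not ∘ inS) (applyUpTo suc n))
    ≡⟨ cong (λ l → compC (suc n) (filterᵇ (not ∘ inS) l)) (applyUpTo-shift suc 1 n (λ _ → refl)) ⟩
  compC (suc n) (filterᵇ (not ∘ inS) (rangeFrom 1 n))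
    ≡⟨ cong (λ l → compC (suc n) (filterᵇ (not ∘ inS) (rangeFrom 1 l))) (length-map flipStep rs) ⟨
  compC (suc n) (filterᵇ (not ∘ inS) (rangeFrom 1 (length rs′)))
    ≡⟨ cong (compC (suc n)) (filterᵇ-rangeFrom (not ∘ inS) 1 rs′
                              (Marks-flipStep 1 rs ne (strictPositions-marks 1 rs))) ⟩
  diffs 0 (strictPositions 1 rs′ ++ [ suc n ])
    ≡⟨ cong (λ l → diffs 0 (strictPositions 1 rs′ ++ [ suc l ])) (length-map flipStep rs) ⟨
  diffs 0 (strictPositions 1 rs′ ++ [ suc (length rs′) ])
    ≡⟨ diffs-strictPositions rs′ 0 0 ⟩
  addToHead 0 (runs rs′)
    ≡⟨ addToHead-zero (runs rs′) ⟩
  runs rs′ ∎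
  where
  n : ℕ
  n = length rs
  rs′ : List Step
  rs′ = map flipStep rs
  inS : ℕ → Bool
  inS j = memᵇ j (strictPositions 1 rs)

sucLast : List ℕ → List ℕ
sucLast []           = []
sucLast (a ∷ [])     = suc a ∷ []
sucLast (a ∷ b ∷ as) = a ∷ sucLast (b ∷ as)

sucLast-∷ : ∀ a α → α ≢ [] → sucLast (a ∷ α) ≡ a ∷ sucLast α
sucLast-∷ a []      ne = ⊥-elim (ne refl)
sucLast-∷ a (_ ∷ _) ne = refl

sucLast-∷ʳ : ∀ α a → sucLast (α ++ [ a ]) ≡ α ++ [ suc a ]
sucLast-∷ʳ []           a = refl
sucLast-∷ʳ (x ∷ [])     a = refl
sucLast-∷ʳ (x ∷ y ∷ α)  a = cong (x ∷_) (sucLast-∷ʳ (y ∷ α) a)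

sucHead-sucLast : ∀ α → sucHead (sucLast α) ≡ sucLast (sucHead α)
sucHead-sucLast []           = refl
sucHead-sucLast (a ∷ [])     = refl
sucHead-sucLast (a ∷ b ∷ as) = refl

sucHead-++ : ∀ α β → α ≢ [] → sucHead (α ++ β) ≡ sucHead α ++ β
sucHead-++ []      β ne = ⊥-elim (ne refl)
sucHead-++ (a ∷ α) β ne = refl

reverse-sucHead : ∀ α → reverse (sucHead α) ≡ sucLast (reverse α)
reverse-sucHead []       = refl
reverse-sucHead (a ∷ as) = begin
  reverse (suc a ∷ as)           ≡⟨ unfold-reverse (suc a) as ⟩
  reverse as ++ [ suc a ]        ≡⟨ sucLast-∷ʳ (reverse as) a ⟨
  sucLast (reverse as ++ [ a ])  ≡⟨ cong sucLast (unfold-reverse a as) ⟨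
  sucLast (reverse (a ∷ as))     ∎

runs-∷ʳ-strict : ∀ rs → runs (rs ++ [ strict ]) ≡ runs rs ++ [ 1 ]
runs-∷ʳ-strict []            = refl
runs-∷ʳ-strict (strict ∷ rs) = cong (1 ∷_) (runs-∷ʳ-strict rs)
runs-∷ʳ-strict (weak ∷ rs)   =
  trans (cong sucHead (runs-∷ʳ-strict rs)) (sucHead-++ (runs rs) _ (runs≢[] rs))
runs-∷ʳ-strict (equal ∷ rs)  =
  trans (cong sucHead (runs-∷ʳ-strict rs)) (sucHead-++ (runs rs) _ (runs≢[] rs))

runs-∷ʳ-nonstrict : ∀ r rs → r ≢ strict → runs (rs ++ [ r ]) ≡ sucLast (runs rs)
runs-∷ʳ-nonstrict weak   []            _  = refl
runs-∷ʳ-nonstrict equal  []            _  = refl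
runs-∷ʳ-nonstrict strict []            ns = ⊥-elim (ns refl)
runs-∷ʳ-nonstrict r      (strict ∷ rs) ns =
  trans (cong (1 ∷_) (runs-∷ʳ-nonstrict r rs ns)) (sym (sucLast-∷ 1 (runs rs) (runs≢[] rs)))
runs-∷ʳ-nonstrict r      (weak ∷ rs)   ns =
  trans (cong sucHead (runs-∷ʳ-nonstrict r rs ns)) (sucHead-sucLast (runs rs))
runs-∷ʳ-nonstrict r      (equal ∷ rs)  ns =
  trans (cong sucHead (runs-∷ʳ-nonstrict r rs ns)) (sucHead-sucLast (runs rs))

reverse-runs : ∀ rs → reverse (runs rs) ≡ runs (reverse rs)
reverse-runs [] = refl
reverse-runs (strict ∷ rs) = begin
  reverse (1 ∷ runs rs)          ≡⟨ unfold-reverse 1 (runs rs) ⟩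
  reverse (runs rs) ++ [ 1 ]     ≡⟨ cong (_++ [ 1 ]) (reverse-runs rs) ⟩
  runs (reverse rs) ++ [ 1 ]     ≡⟨ runs-∷ʳ-strict (reverse rs) ⟨
  runs (reverse rs ++ [ strict ]) ≡⟨ cong runs (unfold-reverse strict rs) ⟨
  runs (reverse (strict ∷ rs))   ∎
reverse-runs (weak ∷ rs) = begin
  reverse (sucHead (runs rs))    ≡⟨ reverse-sucHead (runs rs) ⟩
  sucLast (reverse (runs rs))    ≡⟨ cong sucLast (reverse-runs rs) ⟩
  sucLast (runs (reverse rs))    ≡⟨ runs-∷ʳ-nonstrict weak (reverse rs) (λ ()) ⟨
  runs (reverse rs ++ [ weak ])  ≡⟨ cong runs (unfold-reverse weak rs) ⟨
  runs (reverse (weak ∷ rs))     ∎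
reverse-runs (equal ∷ rs) = begin
  reverse (sucHead (runs rs))    ≡⟨ reverse-sucHead (runs rs) ⟩
  sucLast (reverse (runs rs))    ≡⟨ cong sucLast (reverse-runs rs) ⟩
  sucLast (runs (reverse rs))    ≡⟨ runs-∷ʳ-nonstrict equal (reverse rs) (λ ()) ⟨
  runs (reverse rs ++ [ equal ]) ≡⟨ cong runs (unfold-reverse equal rs) ⟨
  runs (reverse (equal ∷ rs))    ∎

-- Inclusion–exclusion over equal steps

indicator : Bool → ℤ
indicator true  = 1ℤ
indicator false = 0ℤ

indicator-∧ : ∀ x y → indicator (x ∧ y) ≡ indicator x *ℤ indicator y
indicator-∧ true  y = sym (ℤ.*-identityˡ _)
indicator-∧ false y = refl

<ᵇ-suc : ∀ a b → (a <ᵇ suc b) ≡ (a ≤ᵇ b)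
<ᵇ-suc zero    b = refl
<ᵇ-suc (suc a) b = refl

indicator-≡ᵇ : ∀ a b → indicator (a ≤ᵇ b) -ℤ indicator (a <ᵇ b) ≡ indicator (a ≡ᵇ b)
indicator-≡ᵇ zero    zero    = refl
indicator-≡ᵇ zero    (suc b) = refl
indicator-≡ᵇ (suc a) zero    = refl
indicator-≡ᵇ (suc a) (suc b) =
  trans (cong (λ x → indicator x -ℤ indicator (a <ᵇ b)) (<ᵇ-suc a b)) (indicator-≡ᵇ a b)

-- Evaluates H at every equality-free word obtained from R by resolving each equal step,
-- with sign, as weak − strict: the inclusion–exclusion [a = b] = [a ≤ b] − [a < b].
resolve : (List Step → ℤ) → List Step → ℤ
resolve H []           = H []
resolve H (weak ∷ R)   = resolve (H ∘ (weak ∷_)) R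
resolve H (strict ∷ R) = resolve (H ∘ (strict ∷_)) R
resolve H (equal ∷ R)  = resolve (H ∘ (weak ∷_)) R -ℤ resolve (H ∘ (strict ∷_)) R

resolve-cong : ∀ R {H H′ : List Step → ℤ} →
  (∀ rs → EqualityFree rs → length rs ≡ length R → H rs ≡ H′ rs) → resolve H R ≡ resolve H′ R
resolve-cong []           H≗H′ = H≗H′ [] [] refl
resolve-cong (weak ∷ R)   H≗H′ = resolve-cong R (λ rs ne len → H≗H′ (weak ∷ rs) ((λ ()) ∷ ne) (cong suc len))
resolve-cong (strict ∷ R) H≗H′ = resolve-cong R (λ rs ne len → H≗H′ (strict ∷ rs) ((λ ()) ∷ ne) (cong suc len))
resolve-cong (equal ∷ R)  H≗H′ = cong₂ _-ℤ_
  (resolve-cong R (λ rs ne len → H≗H′ (weak ∷ rs) ((λ ()) ∷ ne) (cong suc len)))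
  (resolve-cong R (λ rs ne len → H≗H′ (strict ∷ rs) ((λ ()) ∷ ne) (cong suc len)))

resolve-*ˡ : ∀ R (H : List Step → ℤ) t → resolve (λ rs → t *ℤ H rs) R ≡ t *ℤ resolve H R
resolve-*ˡ []           H t = refl
resolve-*ˡ (weak ∷ R)   H t = resolve-*ˡ R (H ∘ (weak ∷_)) t
resolve-*ˡ (strict ∷ R) H t = resolve-*ˡ R (H ∘ (strict ∷_)) t
resolve-*ˡ (equal ∷ R)  H t =
  trans (cong₂ _-ℤ_ (resolve-*ˡ R (H ∘ (weak ∷_)) t) (resolve-*ˡ R (H ∘ (strict ∷_)) t))
        (*-distribˡ-- t _ _)
  where
  *-distribˡ-- : ∀ t x y → t *ℤ x -ℤ t *ℤ y ≡ t *ℤ (x -ℤ y)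
  *-distribˡ-- = solve-∀

resolve-+ : ∀ R (H H′ : List Step → ℤ) → resolve (λ rs → H rs +ℤ H′ rs) R ≡ resolve H R +ℤ resolve H′ R
resolve-+ []           H H′ = refl
resolve-+ (weak ∷ R)   H H′ = resolve-+ R (H ∘ (weak ∷_)) (H′ ∘ (weak ∷_))
resolve-+ (strict ∷ R) H H′ = resolve-+ R (H ∘ (strict ∷_)) (H′ ∘ (strict ∷_))
resolve-+ (equal ∷ R)  H H′ =
  trans (cong₂ _-ℤ_ (resolve-+ R (H ∘ (weak ∷_)) (H′ ∘ (weak ∷_)))
                    (resolve-+ R (H ∘ (strict ∷_)) (H′ ∘ (strict ∷_))))
        (interchange (resolve (H ∘ (weak ∷_)) R) (resolve (H′ ∘ (weak ∷_)) R)
                     (resolve (H ∘ (strict ∷_)) R) (resolve (H′ ∘ (strict ∷_)) R))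
  where
  interchange : ∀ a b c d → (a +ℤ b) -ℤ (c +ℤ d) ≡ (a -ℤ c) +ℤ (b -ℤ d)
  interchange = solve-∀

resolve-0 : ∀ R → resolve (λ _ → 0ℤ) R ≡ 0ℤ
resolve-0 []           = refl
resolve-0 (weak ∷ R)   = resolve-0 R
resolve-0 (strict ∷ R) = resolve-0 R
resolve-0 (equal ∷ R)  = cong₂ _-ℤ_ (resolve-0 R) (resolve-0 R)

equalCount : List Step → ℕ
equalCount []          = 0
equalCount (equal ∷ R) = suc (equalCount R)
equalCount (_ ∷ R)     = equalCount R

-- Swapping weak and strict turns each weak − strict into its negative.
resolve-flipStep : ∀ R (H : List Step → ℤ) →
  resolve (H ∘ map flipStep) R ≡ sign (equalCount R) *ℤ resolve H (map flipStep R)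
resolve-flipStep []           H = sym (ℤ.*-identityˡ _)
resolve-flipStep (weak ∷ R)   H = resolve-flipStep R (H ∘ (strict ∷_))
resolve-flipStep (strict ∷ R) H = resolve-flipStep R (H ∘ (weak ∷_))
resolve-flipStep (equal ∷ R)  H =
  trans (cong₂ _-ℤ_ (resolve-flipStep R (H ∘ (strict ∷_))) (resolve-flipStep R (H ∘ (weak ∷_))))
        (negate-swap (sign (equalCount R)) _ _)
  where
  negate-swap : ∀ s x y → s *ℤ x -ℤ s *ℤ y ≡ (- (+ 1) *ℤ s) *ℤ (y -ℤ x)
  negate-swap = solve-∀

resolve-satisfiesᵇ : ∀ R ys → length ys ≡ suc (length R) →
  resolve (λ rs → indicator (satisfiesᵇ rs ys)) R ≡ indicator (satisfiesᵇ R ys)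
resolve-satisfiesᵇ []      (a ∷ [])     _   = refl
resolve-satisfiesᵇ (r ∷ R) (a ∷ b ∷ ys) len = trans (firstStep r) (sym (indicator-∧ (stepᵇ r a b) _))
  where
  rest : ℤ
  rest = indicator (satisfiesᵇ R (b ∷ ys))
  guarded : ∀ x → resolve (λ rs → indicator (x ∧ satisfiesᵇ rs (b ∷ ys))) R ≡ indicator x *ℤ rest
  guarded x = begin
    resolve (λ rs → indicator (x ∧ satisfiesᵇ rs (b ∷ ys))) R
      ≡⟨ resolve-cong R (λ rs _ _ → indicator-∧ x _) ⟩
    resolve (λ rs → indicator x *ℤ indicator (satisfiesᵇ rs (b ∷ ys))) R
      ≡⟨ resolve-*ˡ R _ (indicator x) ⟩
    indicator x *ℤ resolve (λ rs → indicator (satisfiesᵇ rs (b ∷ ys))) R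
      ≡⟨ cong (indicator x *ℤ_) (resolve-satisfiesᵇ R (b ∷ ys) (suc-injective len)) ⟩
    indicator x *ℤ rest ∎
  firstStep : ∀ r → resolve (λ rs → indicator (satisfiesᵇ rs (a ∷ b ∷ ys))) (r ∷ R)
                    ≡ indicator (stepᵇ r a b) *ℤ rest
  firstStep weak   = guarded (a ≤ᵇ b)
  firstStep strict = guarded (a <ᵇ b)
  firstStep equal  = begin
    resolve (λ rs → indicator ((a ≤ᵇ b) ∧ satisfiesᵇ rs (b ∷ ys))) R
      -ℤ resolve (λ rs → indicator ((a <ᵇ b) ∧ satisfiesᵇ rs (b ∷ ys))) R
      ≡⟨ cong₂ _-ℤ_ (guarded (a ≤ᵇ b)) (guarded (a <ᵇ b)) ⟩
    indicator (a ≤ᵇ b) *ℤ rest -ℤ indicator (a <ᵇ b) *ℤ rest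
      ≡⟨ *-distribʳ-- (indicator (a ≤ᵇ b)) (indicator (a <ᵇ b)) rest ⟩
    (indicator (a ≤ᵇ b) -ℤ indicator (a <ᵇ b)) *ℤ rest
      ≡⟨ cong (_*ℤ rest) (indicator-≡ᵇ a b) ⟩
    indicator (a ≡ᵇ b) *ℤ rest ∎
    where
    *-distribʳ-- : ∀ x y z → x *ℤ z -ℤ y *ℤ z ≡ (x -ℤ y) *ℤ z
    *-distribʳ-- = solve-∀

prepend : Step → ℤ × List Step → ℤ × List Step
prepend r (c , rs) = c , r ∷ rs

negate : ℤ × List Step → ℤ × List Step
negate (c , rs) = - c , rs

resolution : List Step → List (ℤ × List Step)
resolution []           = (1ℤ , []) ∷ []
resolution (weak ∷ R)   = map (prepend weak) (resolution R)
resolution (strict ∷ R) = map (prepend strict) (resolution R)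
resolution (equal ∷ R)  = map (prepend weak) (resolution R) ++ map (negate ∘ prepend strict) (resolution R)

signedSum : (List Step → ℤ) → List (ℤ × List Step) → ℤ
signedSum H []             = 0ℤ
signedSum H ((c , rs) ∷ L) = c *ℤ H rs +ℤ signedSum H L

signedSum-++ : ∀ H L L′ → signedSum H (L ++ L′) ≡ signedSum H L +ℤ signedSum H L′
signedSum-++ H []             L′ = sym (ℤ.+-identityˡ _)
signedSum-++ H ((c , rs) ∷ L) L′ =
  trans (cong (c *ℤ H rs +ℤ_) (signedSum-++ H L L′)) (sym (ℤ.+-assoc (c *ℤ H rs) _ _))

signedSum-prepend : ∀ r H L → signedSum H (map (prepend r) L) ≡ signedSum (H ∘ (r ∷_)) L
signedSum-prepend r H []             = refl
signedSum-prepend r H ((c , rs) ∷ L) = cong (c *ℤ H (r ∷ rs) +ℤ_) (signedSum-prepend r H L)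

signedSum-negate : ∀ r H L → signedSum H (map (negate ∘ prepend r) L) ≡ - signedSum (H ∘ (r ∷_)) L
signedSum-negate r H []             = refl
signedSum-negate r H ((c , rs) ∷ L) =
  trans (cong (- c *ℤ H (r ∷ rs) +ℤ_) (signedSum-negate r H L))
        (neg-distrib c (H (r ∷ rs)) (signedSum (H ∘ (r ∷_)) L))
  where
  neg-distrib : ∀ c h s → - c *ℤ h +ℤ - s ≡ - (c *ℤ h +ℤ s)
  neg-distrib = solve-∀

signedSum-resolution : ∀ R H → signedSum H (resolution R) ≡ resolve H R
signedSum-resolution []           H = trans (cong (_+ℤ 0ℤ) (ℤ.*-identityˡ (H []))) (ℤ.+-identityʳ (H []))
signedSum-resolution (weak ∷ R)   H = trans (signedSum-prepend weak H (resolution R)) (signedSum-resolution R _)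
signedSum-resolution (strict ∷ R) H = trans (signedSum-prepend strict H (resolution R)) (signedSum-resolution R _)
signedSum-resolution (equal ∷ R)  H = trans (signedSum-++ H (map (prepend weak) (resolution R)) _)
  (cong₂ _+ℤ_ (trans (signedSum-prepend weak H (resolution R)) (signedSum-resolution R _))
              (trans (signedSum-negate strict H (resolution R)) (cong -_ (signedSum-resolution R _))))

sumℤ : (A → ℤ) → List A → ℤ
sumℤ f []       = 0ℤ
sumℤ f (x ∷ xs) = f x +ℤ sumℤ f xs

sumℤ-cong : ∀ {f g : A → ℤ} xs → (∀ {x} → x ∈ xs → f x ≡ g x) → sumℤ f xs ≡ sumℤ g xs
sumℤ-cong []       f≗g = refl
sumℤ-cong (x ∷ xs) f≗g = cong₂ _+ℤ_ (f≗g (here refl)) (sumℤ-cong xs (f≗g ∘ there))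

countᵇ≡sumℤ : (P : A → Bool) (xs : List A) → + countᵇ P xs ≡ sumℤ (indicator ∘ P) xs
countᵇ≡sumℤ P []       = refl
countᵇ≡sumℤ P (x ∷ xs) = trans (ℤ.pos-+ (if P x then 1 else 0) (countᵇ P xs))
  (cong₂ _+ℤ_ (lift (P x)) (countᵇ≡sumℤ P xs))
  where
  lift : ∀ b → + (if b then 1 else 0) ≡ indicator b
  lift true  = refl
  lift false = refl

resolve-sumℤ : ∀ R (f : List Step → A → ℤ) xs →
  resolve (λ rs → sumℤ (f rs) xs) R ≡ sumℤ (λ x → resolve (λ rs → f rs x) R) xs
resolve-sumℤ R f []       = resolve-0 R
resolve-sumℤ R f (x ∷ xs) = trans (resolve-+ R (λ rs → f rs x) (λ rs → sumℤ (f rs) xs))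
  (cong (resolve (λ rs → f rs x) R +ℤ_) (resolve-sumℤ R f xs))

-- Fundamental quasisymmetric functions as counts of sequences

multiplicity : ∀ {m} → Fin m → List (Fin m) → ℕ
multiplicity i = countᵇ (λ x → toℕ x ≡ᵇ toℕ i)

content : ∀ {m} → List (Fin m) → Vec ℕ m
content l = tabulate (λ i → multiplicity i l)

weightOf : ∀ {m} → Fin m → List (Fin m) → List ℕ → ℕ
weightOf i []      ws       = 0
weightOf i (x ∷ l) []       = 0
weightOf i (x ∷ l) (w ∷ ws) = (if toℕ x ≡ᵇ toℕ i then w else 0) + weightOf i l ws

weightedContent : ∀ {m} → List (Fin m) → List ℕ → Vec ℕ m
weightedContent l ws = tabulate (λ i → weightOf i l ws)

monomial≡weightedContent : ∀ {k} m (v : Vec (Fin m) k) (w : Fin k → ℕ) →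
  monomial m (lookup v) w ≡ weightedContent (toList v) (List.tabulate w)
monomial≡weightedContent {k} m v w = tabulate-cong λ i →
  trans (cong (List.foldr _+_ 0) (map-tabulate {n = k} (λ u → u) (λ u → if toℕ (lookup v u) ≡ᵇ toℕ i then w u else 0)))
        (sumTabulate i v w)
  where
  sumTabulate : ∀ {k} i (v : Vec (Fin m) k) (w : Fin k → ℕ) →
    List.foldr _+_ 0 (List.tabulate (λ u → if toℕ (lookup v u) ≡ᵇ toℕ i then w u else 0))
    ≡ weightOf i (toList v) (List.tabulate w)
  sumTabulate i []      w = refl
  sumTabulate i (x ∷ v) w =
    cong (λ s → (if toℕ x ≡ᵇ toℕ i then w fzero else 0) + s) (sumTabulate i v (w ∘ fsuc))

weightOf-ones : ∀ {m k} i (v : Vec (Fin m) k) →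
  weightOf i (toList v) (List.tabulate {n = k} (λ _ → 1)) ≡ multiplicity i (toList v)
weightOf-ones i []      = refl
weightOf-ones i (x ∷ v) = cong (λ s → (if toℕ x ≡ᵇ toℕ i then 1 else 0) + s) (weightOf-ones i v)

monomial-ones : ∀ {k} m (v : Vec (Fin m) k) → monomial m (lookup v) (λ _ → 1) ≡ content (toList v)
monomial-ones m v = trans (monomial≡weightedContent m v (λ _ → 1)) (tabulate-cong (λ i → weightOf-ones i v))

wordCount : List Step → ℕ → (m : ℕ) → Vec ℕ m → ℕ
wordCount rs n m e = countᵇ (λ l → satisfiesᵇ rs (map toℕ l) ∧ vecEqᵇ (content l) e) (allLists n m)

F-runs : ∀ rs m e → EqualityFree rs → F (runs rs) m e ≡ + wordCount rs (suc (length rs)) m e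
F-runs rs m e ne = cong +_ (begin
  fundamental (sumL (runs rs))
    ≡⟨ cong fundamental (sumL-runs rs) ⟩
  fundamental (suc (length rs))
    ≡⟨ countᵇ-cong (allVec (suc (length rs)) m) (λ v → cong₂ _∧_ (seqOK v) (cong (λ c → vecEqᵇ c e) (monomial-ones m v))) ⟩
  countᵇ (P ∘ toList) (allVec (suc (length rs)) m)
    ≡⟨ countᵇ-map P toList (allVec (suc (length rs)) m) ⟨
  wordCount rs (suc (length rs)) m e ∎)
  where
  fundamental : ℕ → ℕ
  fundamental n = countᵇ (λ v → seqOKᵇ (setC (runs rs)) 1 (vecToList (Vec.map toℕ v))
                                ∧ vecEqᵇ (monomial m (lookup v) (λ _ → 1)) e) (allVec n m)
  P : List (Fin m) → Bool
  P l = satisfiesᵇ rs (map toℕ l) ∧ vecEqᵇ (content l) e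
  seqOK : (v : Vec (Fin m) (suc (length rs))) →
    seqOKᵇ (setC (runs rs)) 1 (vecToList (Vec.map toℕ v)) ≡ satisfiesᵇ rs (map toℕ (toList v))
  seqOK v rewrite vecToList≡toList (Vec.map toℕ v) | toList-map toℕ v =
    seqOKᵇ-runs rs (map toℕ (toList v)) ne (trans (length-map toℕ (toList v)) (length-toList v))

wordCount-resolve : ∀ R m e →
  + wordCount R (suc (length R)) m e ≡ resolve (λ rs → + wordCount rs (suc (length R)) m e) R
wordCount-resolve R m e = sym (begin
  resolve (λ rs → + wordCount rs n m e) R
    ≡⟨ resolve-cong R (λ rs _ _ → countᵇ≡sumℤ (P rs) (allLists n m)) ⟩
  resolve (λ rs → sumℤ (indicator ∘ P rs) (allLists n m)) R
    ≡⟨ resolve-sumℤ R (λ rs → indicator ∘ P rs) (allLists n m) ⟩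
  sumℤ (λ l → resolve (λ rs → indicator (P rs l)) R) (allLists n m)
    ≡⟨ sumℤ-cong (allLists n m) (λ {l} l∈ → resolve-P l (∈-allLists⁻ l∈)) ⟩
  sumℤ (indicator ∘ P R) (allLists n m)
    ≡⟨ countᵇ≡sumℤ (P R) (allLists n m) ⟨
  + wordCount R n m e ∎)
  where
  n : ℕ
  n = suc (length R)
  P : List Step → List (Fin m) → Bool
  P rs l = satisfiesᵇ rs (map toℕ l) ∧ vecEqᵇ (content l) e
  resolve-P : ∀ l → length l ≡ n → resolve (λ rs → indicator (P rs l)) R ≡ indicator (P R l)
  resolve-P l len = begin
    resolve (λ rs → indicator (P rs l)) R
      ≡⟨ resolve-cong R (λ rs _ _ → trans (cong indicator (∧-comm _ b)) (indicator-∧ b _)) ⟩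
    resolve (λ rs → indicator b *ℤ indicator (satisfiesᵇ rs (map toℕ l))) R
      ≡⟨ resolve-*ˡ R (λ rs → indicator (satisfiesᵇ rs (map toℕ l))) (indicator b) ⟩
    indicator b *ℤ resolve (λ rs → indicator (satisfiesᵇ rs (map toℕ l))) R
      ≡⟨ cong (indicator b *ℤ_) (resolve-satisfiesᵇ R (map toℕ l) (trans (length-map toℕ l) len)) ⟩
    indicator b *ℤ indicator (satisfiesᵇ R (map toℕ l))
      ≡⟨ indicator-∧ b _ ⟨
    indicator (b ∧ satisfiesᵇ R (map toℕ l))
      ≡⟨ cong indicator (∧-comm b _) ⟩
    indicator (P R l) ∎
    where
    b : Bool
    b = vecEqᵇ (content l) e

-- Partitions of a labelled chain

T-ext : ∀ {a b} → (T a → T b) → (T b → T a) → a ≡ b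
T-ext {true}  {true}  _ _ = refl
T-ext {true}  {false} f _ = ⊥-elim (f tt)
T-ext {false} {true}  _ g = ⊥-elim (g tt)
T-ext {false} {false} _ _ = refl

T-∧⁻ : ∀ x {y} → T (x ∧ y) → T x × T y
T-∧⁻ x = Equivalence.to (T-∧ {x})

allᵇ⁻ : (P : A → Bool) (xs : List A) → T (allᵇ P xs) → ∀ {x} → x ∈ xs → T (P x)
allᵇ⁻ P (y ∷ xs) t (here refl) = proj₁ (T-∧⁻ (P y) t)
allᵇ⁻ P (y ∷ xs) t (there x∈)  = allᵇ⁻ P xs (proj₂ (T-∧⁻ (P y) t)) x∈

allᵇ⁺ : (P : A → Bool) (xs : List A) → (∀ {x} → x ∈ xs → T (P x)) → T (allᵇ P xs)
allᵇ⁺ P []       _  = tt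
allᵇ⁺ P (y ∷ xs) Px = Equivalence.from T-∧ (Px (here refl) , allᵇ⁺ P xs (Px ∘ there))

T-⇒⁻ : ∀ a b → T (not a ∨ b) → T a → T b
T-⇒⁻ true b t _ = t

T-⇒⁺ : ∀ a b → (T a → T b) → T (not a ∨ b)
T-⇒⁺ true  b f = f tt
T-⇒⁺ false b f = tt

-- The requirement on f(p) = a, f(q) = b for p < q; tie says whether γ(p) precedes γ(q).
partitionPairᵇ : Bool → ℕ → ℕ → Bool
partitionPairᵇ tie a b = (a ≤ᵇ b) ∧ (not (a ≡ᵇ b) ∨ tie)

isPartitionᵇ⁻ : ∀ {k} ltP ltC (γ : Fin k → ℕ) f → T (isPartitionᵇ ltP ltC γ f) →
  ∀ p q → T (ltP p q) → T (partitionPairᵇ (ltC (γ p) (γ q)) (f p) (f q))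
isPartitionᵇ⁻ {k} ltP ltC γ f t p q p<q =
  T-⇒⁻ (ltP p q) _ (allᵇ⁻ _ (allFin k) (allᵇ⁻ _ (allFin k) t (∈-allFin p)) (∈-allFin q)) p<q

isPartitionᵇ⁺ : ∀ {k} ltP ltC (γ : Fin k → ℕ) f →
  (∀ p q → T (ltP p q) → T (partitionPairᵇ (ltC (γ p) (γ q)) (f p) (f q))) →
  T (isPartitionᵇ ltP ltC γ f)
isPartitionᵇ⁺ {k} ltP ltC γ f cond =
  allᵇ⁺ _ (allFin k) λ {p} _ → allᵇ⁺ _ (allFin k) λ {q} _ → T-⇒⁺ (ltP p q) _ (cond p q)

Transitiveᵇ : (ℕ → ℕ → Bool) → Set
Transitiveᵇ c = ∀ x y z → T (c x y) → T (c y z) → T (c x z)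

labelStep : Bool → Step
labelStep true  = weak
labelStep false = strict

-- Consecutive chain elements with labels g, h may take equal values iff g precedes h.
chainWord : (ℕ → ℕ → Bool) → List ℕ → List Step
chainWord c []           = []
chainWord c (g ∷ [])     = []
chainWord c (g ∷ h ∷ gs) = labelStep (c g h) ∷ chainWord c (h ∷ gs)

≤ᵇ∧≢ᵇ : ∀ x y → ((x ≤ᵇ y) ∧ not (x ≡ᵇ y)) ≡ (x <ᵇ y)
≤ᵇ∧≢ᵇ zero    zero    = refl
≤ᵇ∧≢ᵇ zero    (suc y) = refl
≤ᵇ∧≢ᵇ (suc x) zero    = refl
≤ᵇ∧≢ᵇ (suc x) (suc y) = trans (cong (λ b → b ∧ not (x ≡ᵇ y)) (<ᵇ-suc x y)) (≤ᵇ∧≢ᵇ x y)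

partitionPairᵇ-suc : ∀ tie x y → partitionPairᵇ tie (suc x) (suc y) ≡ stepᵇ (labelStep tie) x y
partitionPairᵇ-suc true  x y = begin
  (x <ᵇ suc y) ∧ (not (x ≡ᵇ y) ∨ true) ≡⟨ cong ((x <ᵇ suc y) ∧_) (∨-zeroʳ (not (x ≡ᵇ y))) ⟩
  (x <ᵇ suc y) ∧ true                  ≡⟨ ∧-identityʳ _ ⟩
  x <ᵇ suc y                           ≡⟨ <ᵇ-suc x y ⟩
  x ≤ᵇ y                               ∎
partitionPairᵇ-suc false x y = begin
  (x <ᵇ suc y) ∧ (not (x ≡ᵇ y) ∨ false) ≡⟨ cong ((x <ᵇ suc y) ∧_) (∨-identityʳ (not (x ≡ᵇ y))) ⟩
  (x <ᵇ suc y) ∧ not (x ≡ᵇ y)           ≡⟨ cong (λ b → b ∧ not (x ≡ᵇ y)) (<ᵇ-suc x y) ⟩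
  (x ≤ᵇ y) ∧ not (x ≡ᵇ y)               ≡⟨ ≤ᵇ∧≢ᵇ x y ⟩
  x <ᵇ y                                ∎

labelStep⁻ : ∀ tie a b → T (stepᵇ (labelStep tie) a b) → a ≤ b × (a ≡ b → T tie)
labelStep⁻ true  a b a≤b = ≤ᵇ⇒≤ a b a≤b , λ _ → tt
labelStep⁻ false a b a<b = <⇒≤ (<ᵇ⇒< a b a<b) , λ a≡b → ⊥-elim (<⇒≢ (<ᵇ⇒< a b a<b) a≡b)

labelStep⁺ : ∀ tie a b → a ≤ b → (a ≡ b → T tie) → T (stepᵇ (labelStep tie) a b)
labelStep⁺ true  a b a≤b _ = ≤⇒≤ᵇ a≤b
labelStep⁺ false a b a≤b tie with m≤n⇒m<n∨m≡n a≤b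
... | inj₁ a<b = <⇒<ᵇ a<b
... | inj₂ a≡b = ⊥-elim (tie a≡b)

labelStep-trans : ∀ (c : ℕ → ℕ → Bool) → Transitiveᵇ c → ∀ {g h i a b d} →
  T (stepᵇ (labelStep (c g h)) a b) → T (stepᵇ (labelStep (c h i)) b d) → T (stepᵇ (labelStep (c g i)) a d)
labelStep-trans c c-trans {g} {h} {i} {a} {b} {d} ab bd =
  let a≤b , tie₁ = labelStep⁻ (c g h) a b ab ; b≤d , tie₂ = labelStep⁻ (c h i) b d bd in
  labelStep⁺ (c g i) a d (≤-trans a≤b b≤d) λ a≡d →
    let b≡a = ≤-antisym (subst (b ≤_) (sym a≡d) b≤d) a≤b in
    c-trans g h i (tie₁ (sym b≡a)) (tie₂ (trans b≡a a≡d))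

ChainPartition : ∀ k → (ℕ → ℕ → Bool) → (a γ : Fin k → ℕ) → Set
ChainPartition k c a γ = ∀ p q → toℕ p < toℕ q → T (stepᵇ (labelStep (c (γ p) (γ q))) (a p) (a q))

satisfiesᵇ-chainWord⇒ : ∀ k c → Transitiveᵇ c → (a γ : Fin k → ℕ) →
  T (satisfiesᵇ (chainWord c (List.tabulate γ)) (List.tabulate a)) → ChainPartition k c a γ
satisfiesᵇ-chainWord⇒ (suc zero)    c c-trans a γ t fzero fzero ()
satisfiesᵇ-chainWord⇒ (suc (suc k)) c c-trans a γ t = pairs
  where
  step₀₁ : Bool
  step₀₁ = stepᵇ (labelStep (c (γ fzero) (γ (fsuc fzero)))) (a fzero) (a (fsuc fzero))
  first : T step₀₁
  first = proj₁ (T-∧⁻ step₀₁ t)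
  later : ChainPartition (suc k) c (a ∘ fsuc) (γ ∘ fsuc)
  later = satisfiesᵇ-chainWord⇒ (suc k) c c-trans (a ∘ fsuc) (γ ∘ fsuc) (proj₂ (T-∧⁻ step₀₁ t))
  pairs : ChainPartition (suc (suc k)) c a γ
  pairs fzero    fzero           ()
  pairs fzero    (fsuc fzero)    _         = first
  pairs fzero    (fsuc (fsuc q)) _         = labelStep-trans c c-trans first (later fzero (fsuc q) (s≤s z≤n))
  pairs (fsuc p) fzero           ()
  pairs (fsuc p) (fsuc q)        (s≤s p<q) = later p q p<q

⇒satisfiesᵇ-chainWord : ∀ k c → (a γ : Fin k → ℕ) →
  ChainPartition k c a γ → T (satisfiesᵇ (chainWord c (List.tabulate γ)) (List.tabulate a))
⇒satisfiesᵇ-chainWord zero          c a γ _     = tt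
⇒satisfiesᵇ-chainWord (suc zero)    c a γ _     = tt
⇒satisfiesᵇ-chainWord (suc (suc k)) c a γ pairs = Equivalence.from T-∧
  (pairs fzero (fsuc fzero) (s≤s z≤n) ,
   ⇒satisfiesᵇ-chainWord (suc k) c (a ∘ fsuc) (γ ∘ fsuc) (λ p q p<q → pairs (fsuc p) (fsuc q) (s≤s p<q)))

-- On a chain it suffices to check consecutive elements, by transitivity of the label order.
isPartitionᵇ-chain : ∀ {k} c → Transitiveᵇ c → (γ a : Fin k → ℕ) →
  isPartitionᵇ chainLt c γ (suc ∘ a) ≡ satisfiesᵇ (chainWord c (List.tabulate γ)) (List.tabulate a)
isPartitionᵇ-chain {k} c c-trans γ a = T-ext
  (λ t → ⇒satisfiesᵇ-chainWord k c a γ λ p q p<q →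
     subst T (partitionPairᵇ-suc (c (γ p) (γ q)) (a p) (a q)) (isPartitionᵇ⁻ chainLt c γ (suc ∘ a) t p q (<⇒<ᵇ p<q)))
  (λ t → isPartitionᵇ⁺ chainLt c γ (suc ∘ a) λ p q p<q →
     subst T (sym (partitionPairᵇ-suc (c (γ p) (γ q)) (a p) (a q)))
       (satisfiesᵇ-chainWord⇒ k c c-trans a γ t p q (<ᵇ⇒< _ _ p<q)))

tabulate-lookup : ∀ {m k} (v : Vec (Fin m) k) → List.tabulate (toℕ ∘ lookup v) ≡ map toℕ (toList v)
tabulate-lookup []      = refl
tabulate-lookup (x ∷ v) = cong (toℕ x ∷_) (tabulate-lookup v)

weightedWordCount : List Step → List ℕ → ℕ → (m : ℕ) → Vec ℕ m → ℕ
weightedWordCount rs ws n m e =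
  countᵇ (λ l → satisfiesᵇ rs (map toℕ l) ∧ vecEqᵇ (weightedContent l ws) e) (allLists n m)

K-chain : ∀ k c → Transitiveᵇ c → (γ w : Fin k → ℕ) → ∀ m e →
  K k chainLt c γ w m e ≡ + weightedWordCount (chainWord c (List.tabulate γ)) (List.tabulate w) k m e
K-chain k c c-trans γ w m e = cong +_ (trans
  (countᵇ-cong (allVec k m) λ v → cong₂ _∧_
    (trans (isPartitionᵇ-chain c c-trans γ (toℕ ∘ lookup v)) (cong (satisfiesᵇ (chainWord c (List.tabulate γ))) (tabulate-lookup v)))
    (cong (λ x → vecEqᵇ x e) (monomial≡weightedContent m v w)))
  (sym (countᵇ-map _ toList (allVec k m))))

-- Weights as runs of equal values

-- expand ws l repeats the i-th entry of l (1 + i-th entry of ws) times; compress undoes it.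
expand : List ℕ → List A → List A
expand []       l       = []
expand (w ∷ ws) []      = []
expand (w ∷ ws) (x ∷ l) = x ∷ (replicate w x ++ expand ws l)

compress : List ℕ → List A → List A
compress []       ys       = []
compress (w ∷ ws) []       = []
compress (w ∷ ws) (y ∷ ys) = y ∷ compress ws (drop w ys)

-- The word of the expanded sequence: blocks of equal steps, separated by the steps bs.
blockWord : List ℕ → List Step → List Step
tailWord  : List ℕ → List Step → List Step
blockWord []       bs       = []
blockWord (w ∷ ws) bs       = replicate w equal ++ tailWord ws bs
tailWord  []       bs       = []
tailWord  (w ∷ ws) []       = []
tailWord  (w ∷ ws) (b ∷ bs) = b ∷ blockWord (w ∷ ws) bs

Aligned : List ℕ → List Step → Set
Aligned []            []       = ⊤
Aligned (w ∷ [])      []       = ⊤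
Aligned (w ∷ w′ ∷ ws) (b ∷ bs) = Aligned (w′ ∷ ws) bs
Aligned _             _        = ⊥

blockLength : ∀ w ws → length ws + (w + sumL ws) ≡ w + (length ws + sumL ws)
blockLength w ws = x∙yz≈y∙xz (length ws) w (sumL ws)

length-expand : ∀ ws (l : List A) → length l ≡ length ws → length (expand ws l) ≡ length ws + sumL ws
length-expand []       []      _   = refl
length-expand (w ∷ ws) (x ∷ l) len = cong suc (begin
  length (replicate w x ++ expand ws l)        ≡⟨ length-++ (replicate w x) ⟩
  length (replicate w x) + length (expand ws l) ≡⟨ cong₂ _+_ (length-replicate w) (length-expand ws l (suc-injective len)) ⟩
  w + (length ws + sumL ws)                    ≡⟨ blockLength w ws ⟨
  length ws + (w + sumL ws)                    ∎)

length-drop-block : ∀ w ws (ys : List A) → length ys ≡ length ws + (w + sumL ws) →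
  length (drop w ys) ≡ length ws + sumL ws
length-drop-block w ws ys len =
  trans (length-drop w ys) (trans (cong (_∸ w) (trans len (blockLength w ws))) (m+n∸m≡n w _))

length-compress : ∀ ws (ys : List A) → length ys ≡ length ws + sumL ws → length (compress ws ys) ≡ length ws
length-compress []       []       _   = refl
length-compress (w ∷ ws) (y ∷ ys) len =
  cong suc (length-compress ws (drop w ys) (length-drop-block w ws ys (suc-injective len)))

map-expand : ∀ (f : A → B) ws l → map f (expand ws l) ≡ expand ws (map f l)
map-expand f []       l       = refl
map-expand f (w ∷ ws) []      = refl
map-expand f (w ∷ ws) (x ∷ l) = cong (f x ∷_) (begin
  map f (replicate w x ++ expand ws l)             ≡⟨ map-++ f (replicate w x) _ ⟩
  map f (replicate w x) ++ map f (expand ws l)     ≡⟨ cong₂ _++_ (map-replicate f w x) (map-expand f ws l) ⟩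
  replicate w (f x) ++ expand ws (map f l)         ∎)

drop-replicate-++ : ∀ w (x : A) ys → drop w (replicate w x ++ ys) ≡ ys
drop-replicate-++ zero    x ys = refl
drop-replicate-++ (suc w) x ys = drop-replicate-++ w x ys

compress-expand : ∀ ws (l : List A) → length l ≡ length ws → compress ws (expand ws l) ≡ l
compress-expand []       []      _   = refl
compress-expand (w ∷ ws) (x ∷ l) len = cong (x ∷_)
  (trans (cong (compress ws) (drop-replicate-++ w x _)) (compress-expand ws l (suc-injective len)))

satisfiesᵇ-equals : ∀ w x R ys → satisfiesᵇ (replicate w equal ++ R) (x ∷ (replicate w x ++ ys)) ≡ satisfiesᵇ R (x ∷ ys)
satisfiesᵇ-equals zero    x R ys = refl
satisfiesᵇ-equals (suc w) x R ys rewrite ≡ᵇ-refl x = satisfiesᵇ-equals w x R ys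

satisfiesᵇ-expand : ∀ ws bs (l : List ℕ) → Aligned ws bs → length l ≡ length ws →
  satisfiesᵇ (blockWord ws bs) (expand ws l) ≡ satisfiesᵇ bs l
satisfiesᵇ-expand []            []       []           _       _   = refl
satisfiesᵇ-expand (w ∷ [])      []       (x ∷ [])     _       _   = satisfiesᵇ-equals w x [] []
satisfiesᵇ-expand (w ∷ w′ ∷ ws) (b ∷ bs) (x ∷ x′ ∷ l) aligned len =
  trans (satisfiesᵇ-equals w x _ _)
        (cong (stepᵇ b x x′ ∧_) (satisfiesᵇ-expand (w′ ∷ ws) bs (x′ ∷ l) aligned (suc-injective len)))

countᵇ-++ : (P : A → Bool) (xs ys : List A) → countᵇ P (xs ++ ys) ≡ countᵇ P xs + countᵇ P ys
countᵇ-++ P []       ys = refl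
countᵇ-++ P (x ∷ xs) ys =
  trans (cong (λ c → (if P x then 1 else 0) + c) (countᵇ-++ P xs ys)) (sym (+-assoc (if P x then 1 else 0) _ _))

multiplicity-replicate : ∀ {m} (i : Fin m) w x → multiplicity i (replicate w x) ≡ (if toℕ x ≡ᵇ toℕ i then w else 0)
multiplicity-replicate i zero    x with toℕ x ≡ᵇ toℕ i
... | true  = refl
... | false = refl
multiplicity-replicate i (suc w) x with toℕ x ≡ᵇ toℕ i in x≡ᵇi
... | true  = cong suc (trans (multiplicity-replicate i w x) (cong (λ b → if b then w else 0) x≡ᵇi))
... | false = trans (multiplicity-replicate i w x) (cong (λ b → if b then w else 0) x≡ᵇi)

multiplicity-expand : ∀ {m} (i : Fin m) ws l → length l ≡ length ws →
  multiplicity i (expand ws l) ≡ weightOf i l (map suc ws)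
multiplicity-expand i []       []      _   = refl
multiplicity-expand i (w ∷ ws) (x ∷ l) len =
  trans (cong (λ c → (if toℕ x ≡ᵇ toℕ i then 1 else 0) + c)
          (trans (countᵇ-++ _ (replicate w x) _)
                 (cong₂ _+_ (multiplicity-replicate i w x) (multiplicity-expand i ws l (suc-injective len)))))
        (merge (toℕ x ≡ᵇ toℕ i))
  where
  merge : ∀ b → (if b then 1 else 0) + ((if b then w else 0) + weightOf i l (map suc ws))
              ≡ (if b then suc w else 0) + weightOf i l (map suc ws)
  merge true  = refl
  merge false = refl

equals-split : ∀ {m} w (y : Fin m) ys R → T (satisfiesᵇ (replicate w equal ++ R) (map toℕ (y ∷ ys))) →
  w ≤ length ys → ys ≡ replicate w y ++ drop w ys × T (satisfiesᵇ R (map toℕ (y ∷ drop w ys)))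
equals-split zero    y ys        R t _         = refl , t
equals-split (suc w) y (y′ ∷ ys) R t (s≤s w≤) =
  let y≡ᵇy′ , t′ = T-∧⁻ (toℕ y ≡ᵇ toℕ y′) t
      y≡y′ = toℕ-injective (≡ᵇ⇒≡ (toℕ y) (toℕ y′) y≡ᵇy′)
      split , rest = equals-split w y′ ys R t′ w≤
  in subst (λ z → y′ ∷ ys ≡ z ∷ replicate w z ++ drop w ys × T (satisfiesᵇ R (map toℕ (z ∷ drop w ys))))
           (sym y≡y′) (cong (y′ ∷_) split , rest)

expand-compress : ∀ {m} ws bs (ys : List (Fin m)) → Aligned ws bs → length ys ≡ length ws + sumL ws →
  T (satisfiesᵇ (blockWord ws bs) (map toℕ ys)) → expand ws (compress ws ys) ≡ ys
expand-compress []       []  []       _       _   _ = refl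
expand-compress (w ∷ ws) bs  (y ∷ ys) aligned len t =
  let split , rest = equals-split w y ys (tailWord ws bs) t w≤
  in trans (cong (λ z → y ∷ (replicate w y ++ z)) (tail ws bs aligned (drop w ys) len′ rest))
           (cong (y ∷_) (sym split))
  where
  len′ : length (drop w ys) ≡ length ws + sumL ws
  len′ = length-drop-block w ws ys (suc-injective len)
  w≤ : w ≤ length ys
  w≤ = subst (w ≤_) (sym (trans (suc-injective len) (blockLength w ws))) (m≤m+n w _)
  tail : ∀ ws bs → Aligned (w ∷ ws) bs → ∀ zs → length zs ≡ length ws + sumL ws →
    T (satisfiesᵇ (tailWord ws bs) (map toℕ (y ∷ zs))) → expand ws (compress ws zs) ≡ zs
  tail []        []       _       []       _   _ = refl
  tail (w′ ∷ ws) (b ∷ bs) aligned (z ∷ zs) len t =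
    expand-compress (w′ ∷ ws) bs (z ∷ zs) aligned len (proj₂ (T-∧⁻ (stepᵇ b (toℕ y) (toℕ z)) t))

-- Repeating the value of an element of weight 1 + w exactly w more times, with equal
-- steps in between, turns weighted sequences into ordinary ones.
weightedWordCount-expand : ∀ {m} ws bs (e : Vec ℕ m) → Aligned ws bs →
  weightedWordCount bs (map suc ws) (length ws) m e ≡ wordCount (blockWord ws bs) (length ws + sumL ws) m e
weightedWordCount-expand {m} ws bs e aligned =
  countᵇ-bijection (allLists-unique _ m) (allLists-unique _ m) P Q (expand ws) (compress ws) to from
  where
  P Q : List (Fin m) → Bool
  P l = satisfiesᵇ bs (map toℕ l) ∧ vecEqᵇ (weightedContent l (map suc ws)) e
  Q l = satisfiesᵇ (blockWord ws bs) (map toℕ l) ∧ vecEqᵇ (content l) e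
  Q∘expand : ∀ l → length l ≡ length ws → Q (expand ws l) ≡ P l
  Q∘expand l len = cong₂ (λ a c → a ∧ vecEqᵇ c e)
    (trans (cong (satisfiesᵇ (blockWord ws bs)) (map-expand toℕ ws l))
           (satisfiesᵇ-expand ws bs (map toℕ l) aligned (trans (length-map toℕ l) len)))
    (tabulate-cong (λ i → multiplicity-expand i ws l len))
  to : ∀ {l} → l ∈ allLists (length ws) m → T (P l) →
    expand ws l ∈ allLists (length ws + sumL ws) m × T (Q (expand ws l)) × compress ws (expand ws l) ≡ l
  to {l} l∈ t = let len = ∈-allLists⁻ l∈ in
    ∈-allLists⁺ _ (length-expand ws l len) , subst T (sym (Q∘expand l len)) t , compress-expand ws l len
  from : ∀ {ys} → ys ∈ allLists (length ws + sumL ws) m → T (Q ys) →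
    compress ws ys ∈ allLists (length ws) m × T (P (compress ws ys)) × expand ws (compress ws ys) ≡ ys
  from {ys} ys∈ t =
    let len = ∈-allLists⁻ ys∈
        clen = length-compress ws ys len
        ec = expand-compress ws bs ys aligned len (proj₁ (T-∧⁻ (satisfiesᵇ (blockWord ws bs) (map toℕ ys)) t))
    in ∈-allLists⁺ _ clen , subst T (trans (cong Q (sym ec)) (Q∘expand (compress ws ys) clen)) t , ec

-- Reversal

<ᵇ≡not-≤ᵇ : ∀ a b → (a <ᵇ b) ≡ not (b ≤ᵇ a)
<ᵇ≡not-≤ᵇ zero    zero    = refl
<ᵇ≡not-≤ᵇ zero    (suc b) = refl
<ᵇ≡not-≤ᵇ (suc a) zero    = refl
<ᵇ≡not-≤ᵇ (suc a) (suc b) = trans (<ᵇ≡not-≤ᵇ a b) (cong not (sym (<ᵇ-suc b a)))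

≡ᵇ≡≤ᵇ∧≥ᵇ : ∀ a b → (a ≡ᵇ b) ≡ (a ≤ᵇ b) ∧ (b ≤ᵇ a)
≡ᵇ≡≤ᵇ∧≥ᵇ zero    zero    = refl
≡ᵇ≡≤ᵇ∧≥ᵇ zero    (suc b) = refl
≡ᵇ≡≤ᵇ∧≥ᵇ (suc a) zero    = refl
≡ᵇ≡≤ᵇ∧≥ᵇ (suc a) (suc b) = trans (≡ᵇ≡≤ᵇ∧≥ᵇ a b) (sym (cong₂ _∧_ (<ᵇ-suc a b) (<ᵇ-suc b a)))

opposite-≤ : ∀ {m} {x y : Fin m} → toℕ x ≤ toℕ y → toℕ (opposite y) ≤ toℕ (opposite x)
opposite-≤ {m} {x} {y} x≤y rewrite opposite-prop x | opposite-prop y = ∸-monoʳ-≤ m (s≤s x≤y)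

≤ᵇ-opposite : ∀ {m} (x y : Fin m) → (toℕ (opposite y) ≤ᵇ toℕ (opposite x)) ≡ (toℕ x ≤ᵇ toℕ y)
≤ᵇ-opposite x y = T-ext
  (λ t → ≤⇒≤ᵇ (subst₂ (λ a b → toℕ a ≤ toℕ b) (opposite-involutive x) (opposite-involutive y)
                        (opposite-≤ (≤ᵇ⇒≤ (toℕ (opposite y)) (toℕ (opposite x)) t))))
  (λ t → ≤⇒≤ᵇ (opposite-≤ {x = x} {y} (≤ᵇ⇒≤ (toℕ x) (toℕ y) t)))

stepᵇ-opposite : ∀ {m} r (x y : Fin m) → stepᵇ r (toℕ (opposite y)) (toℕ (opposite x)) ≡ stepᵇ r (toℕ x) (toℕ y)
stepᵇ-opposite weak   x y = ≤ᵇ-opposite x y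
stepᵇ-opposite strict x y =
  trans (<ᵇ≡not-≤ᵇ (toℕ (opposite y)) (toℕ (opposite x)))
        (trans (cong not (≤ᵇ-opposite y x)) (sym (<ᵇ≡not-≤ᵇ (toℕ x) (toℕ y))))
stepᵇ-opposite equal  x y =
  trans (≡ᵇ≡≤ᵇ∧≥ᵇ (toℕ (opposite y)) (toℕ (opposite x)))
        (trans (cong₂ _∧_ (≤ᵇ-opposite x y) (≤ᵇ-opposite y x)) (sym (≡ᵇ≡≤ᵇ∧≥ᵇ (toℕ x) (toℕ y))))

≡ᵇ-opposite : ∀ {m} (x i : Fin m) → (toℕ (opposite x) ≡ᵇ toℕ i) ≡ (toℕ x ≡ᵇ toℕ (opposite i))
≡ᵇ-opposite x i = T-ext
  (λ t → ≡⇒≡ᵇ _ _ (cong toℕ (trans (sym (opposite-involutive x)) (cong opposite (toℕ-injective (≡ᵇ⇒≡ _ _ t))))))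
  (λ t → ≡⇒≡ᵇ _ _ (cong toℕ (trans (cong opposite (toℕ-injective (≡ᵇ⇒≡ _ _ t))) (opposite-involutive i))))

-- The exponent vector after the substitution xᵢ ↦ x_{m+1-i} of the variables x₁, …, x_m.
reverseVars : ∀ {m} → Vec ℕ m → Vec ℕ m
reverseVars e = tabulate (lookup e ∘ opposite)

reverseVars-involutive : ∀ {m} (e : Vec ℕ m) → reverseVars (reverseVars e) ≡ e
reverseVars-involutive e =
  trans (tabulate-cong λ i → trans (lookup∘tabulate _ (opposite i)) (cong (lookup e) (opposite-involutive i)))
        (tabulate∘lookup e)

vecEqᵇ⇒≡ : ∀ {m} (a b : Vec ℕ m) → T (vecEqᵇ a b) → a ≡ b
vecEqᵇ⇒≡ []      []      _ = refl
vecEqᵇ⇒≡ (x ∷ a) (y ∷ b) t =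
  let x≡y , a≡b = T-∧⁻ (x ≡ᵇ y) t in cong₂ _∷_ (≡ᵇ⇒≡ x y x≡y) (vecEqᵇ⇒≡ a b a≡b)

vecEqᵇ-refl : ∀ {m} (a : Vec ℕ m) → T (vecEqᵇ a a)
vecEqᵇ-refl []      = tt
vecEqᵇ-refl (x ∷ a) = Equivalence.from T-∧ (≡⇒≡ᵇ x x refl , vecEqᵇ-refl a)

vecEqᵇ-reverseVars : ∀ {m} (a e : Vec ℕ m) → vecEqᵇ (reverseVars a) e ≡ vecEqᵇ a (reverseVars e)
vecEqᵇ-reverseVars a e = T-ext
  (λ t → subst (T ∘ vecEqᵇ a) (trans (sym (reverseVars-involutive a)) (cong reverseVars (vecEqᵇ⇒≡ (reverseVars a) e t)))
               (vecEqᵇ-refl a))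
  (λ t → subst (T ∘ vecEqᵇ (reverseVars a)) (trans (cong reverseVars (vecEqᵇ⇒≡ a (reverseVars e) t)) (reverseVars-involutive e))
               (vecEqᵇ-refl (reverseVars a)))

monomial-opposite : ∀ {m k} (v : Vec (Fin m) k) (w : Fin k → ℕ) →
  monomial m (lookup (Vec.map opposite v)) w ≡ reverseVars (monomial m (lookup v) w)
monomial-opposite {m} {k} v w = tabulate-cong λ i → trans
  (cong (List.foldr _+_ 0) (map-cong (λ u → cong (λ b → if b then w u else 0)
     (trans (cong (λ x → toℕ x ≡ᵇ toℕ i) (lookup-map u opposite v)) (≡ᵇ-opposite (lookup v u) i))) (allFin k)))
  (sym (lookup∘tabulate _ (opposite i)))

map-opposite-involutive : ∀ {m k} (v : Vec (Fin m) k) → Vec.map opposite (Vec.map opposite v) ≡ v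
map-opposite-involutive []      = refl
map-opposite-involutive (x ∷ v) = cong₂ _∷_ (opposite-involutive x) (map-opposite-involutive v)

isPartitionᵇ-opposite : ∀ {m k} c (γ : Fin k → ℕ) (v : Vec (Fin m) k) →
  isPartitionᵇ chainLt (dualᵇ c) γ (suc ∘ toℕ ∘ lookup (Vec.map opposite v))
  ≡ isPartitionᵇ (dualᵇ chainLt) c γ (suc ∘ toℕ ∘ lookup v)
isPartitionᵇ-opposite {k = k} c γ v = T-ext
  (λ t → isPartitionᵇ⁺ (dualᵇ chainLt) c γ f λ p q q<p →
     subst T (pair p q) (isPartitionᵇ⁻ chainLt (dualᵇ c) γ f̄ t q p q<p))
  (λ t → isPartitionᵇ⁺ chainLt (dualᵇ c) γ f̄ λ q p q<p →
     subst T (sym (pair p q)) (isPartitionᵇ⁻ (dualᵇ chainLt) c γ f t p q q<p))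
  where
  f f̄ : Fin k → ℕ
  f  = suc ∘ toℕ ∘ lookup v
  f̄ = suc ∘ toℕ ∘ lookup (Vec.map opposite v)
  pair : ∀ p q → partitionPairᵇ (c (γ p) (γ q)) (f̄ q) (f̄ p) ≡ partitionPairᵇ (c (γ p) (γ q)) (f p) (f q)
  pair p q = begin
    partitionPairᵇ (c (γ p) (γ q)) (f̄ q) (f̄ p)
      ≡⟨ partitionPairᵇ-suc (c (γ p) (γ q)) _ _ ⟩
    stepᵇ step (toℕ (lookup (Vec.map opposite v) q)) (toℕ (lookup (Vec.map opposite v) p))
      ≡⟨ cong₂ (λ a b → stepᵇ step (toℕ a) (toℕ b)) (lookup-map q opposite v) (lookup-map p opposite v) ⟩
    stepᵇ step (toℕ (opposite (lookup v q))) (toℕ (opposite (lookup v p)))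
      ≡⟨ stepᵇ-opposite step (lookup v p) (lookup v q) ⟩
    stepᵇ step (toℕ (lookup v p)) (toℕ (lookup v q))
      ≡⟨ partitionPairᵇ-suc (c (γ p) (γ q)) _ _ ⟨
    partitionPairᵇ (c (γ p) (γ q)) (f p) (f q) ∎
    where
    step : Step
    step = labelStep (c (γ p) (γ q))

-- Reflecting the values of a partition of the dual chain gives a partition of the chain.
K-dualChain : ∀ k c (γ w : Fin k → ℕ) m e →
  K k (dualᵇ chainLt) c γ w m e ≡ K k chainLt (dualᵇ c) γ w m (reverseVars e)
K-dualChain k c γ w m e = cong +_ (countᵇ-bijection (allVec-unique k m) (allVec-unique k m) P Q reflect reflect
  (λ {v} _ t → allVec-complete k m _ , subst T (sym (Q∘reflect v)) t , map-opposite-involutive v)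
  (λ {v} _ t → allVec-complete k m _ ,
     subst T (trans (cong Q (sym (map-opposite-involutive v))) (Q∘reflect (reflect v))) t ,
     map-opposite-involutive v))
  where
  reflect : Vec (Fin m) k → Vec (Fin m) k
  reflect = Vec.map opposite
  P Q : Vec (Fin m) k → Bool
  P v = isPartitionᵇ (dualᵇ chainLt) c γ (suc ∘ toℕ ∘ lookup v) ∧ vecEqᵇ (monomial m (lookup v) w) e
  Q v = isPartitionᵇ chainLt (dualᵇ c) γ (suc ∘ toℕ ∘ lookup v) ∧ vecEqᵇ (monomial m (lookup v) w) (reverseVars e)
  Q∘reflect : ∀ v → Q (reflect v) ≡ P v
  Q∘reflect v = cong₂ _∧_ (isPartitionᵇ-opposite c γ v) (begin
    vecEqᵇ (monomial m (lookup (reflect v)) w) (reverseVars e)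
      ≡⟨ cong (λ a → vecEqᵇ a (reverseVars e)) (monomial-opposite v w) ⟩
    vecEqᵇ (reverseVars (monomial m (lookup v) w)) (reverseVars e)
      ≡⟨ vecEqᵇ-reverseVars (monomial m (lookup v) w) (reverseVars e) ⟩
    vecEqᵇ (monomial m (lookup v) w) (reverseVars (reverseVars e))
      ≡⟨ cong (vecEqᵇ (monomial m (lookup v) w)) (reverseVars-involutive e) ⟩
    vecEqᵇ (monomial m (lookup v) w) e ∎)

satisfiesᵒᵖᵇ : List Step → List ℕ → Bool
satisfiesᵒᵖᵇ []       l           = true
satisfiesᵒᵖᵇ (r ∷ rs) []          = true
satisfiesᵒᵖᵇ (r ∷ rs) (a ∷ [])    = true
satisfiesᵒᵖᵇ (r ∷ rs) (a ∷ b ∷ l) = stepᵇ r b a ∧ satisfiesᵒᵖᵇ rs (b ∷ l)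

satisfiesᵇ-∷ʳ : ∀ rs zs c r a → length zs ≡ length rs →
  satisfiesᵇ (rs ++ [ r ]) (zs ++ c ∷ a ∷ []) ≡ satisfiesᵇ rs (zs ++ [ c ]) ∧ stepᵇ r c a
satisfiesᵇ-∷ʳ []               []               c r a _   = ∧-identityʳ (stepᵇ r c a)
satisfiesᵇ-∷ʳ (r₁ ∷ [])        (z ∷ [])         c r a _   =
  trans (cong (stepᵇ r₁ z c ∧_) (∧-identityʳ (stepᵇ r c a))) (cong (_∧ stepᵇ r c a) (sym (∧-identityʳ (stepᵇ r₁ z c))))
satisfiesᵇ-∷ʳ (r₁ ∷ r₂ ∷ rs)   (z ∷ z′ ∷ zs)    c r a len =
  trans (cong (stepᵇ r₁ z z′ ∧_) (satisfiesᵇ-∷ʳ (r₂ ∷ rs) (z′ ∷ zs) c r a (suc-injective len)))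
        (sym (∧-assoc (stepᵇ r₁ z z′) _ _))

satisfiesᵇ-reverse : ∀ rs ys → length ys ≡ suc (length rs) →
  satisfiesᵇ (reverse rs) (reverse ys) ≡ satisfiesᵒᵖᵇ rs ys
satisfiesᵇ-reverse []       (a ∷ [])     _   = refl
satisfiesᵇ-reverse (r ∷ rs) (a ∷ b ∷ ys) len = begin
  satisfiesᵇ (reverse (r ∷ rs)) (reverse (a ∷ b ∷ ys))
    ≡⟨ cong₂ satisfiesᵇ (unfold-reverse r rs) reversed ⟩
  satisfiesᵇ (reverse rs ++ [ r ]) (reverse ys ++ b ∷ a ∷ [])
    ≡⟨ satisfiesᵇ-∷ʳ (reverse rs) (reverse ys) b r a lengths ⟩
  satisfiesᵇ (reverse rs) (reverse ys ++ [ b ]) ∧ stepᵇ r b a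
    ≡⟨ cong (λ l → satisfiesᵇ (reverse rs) l ∧ stepᵇ r b a) (unfold-reverse b ys) ⟨
  satisfiesᵇ (reverse rs) (reverse (b ∷ ys)) ∧ stepᵇ r b a
    ≡⟨ cong (_∧ stepᵇ r b a) (satisfiesᵇ-reverse rs (b ∷ ys) (suc-injective len)) ⟩
  satisfiesᵒᵖᵇ rs (b ∷ ys) ∧ stepᵇ r b a
    ≡⟨ ∧-comm _ (stepᵇ r b a) ⟩
  stepᵇ r b a ∧ satisfiesᵒᵖᵇ rs (b ∷ ys) ∎
  where
  reversed : reverse (a ∷ b ∷ ys) ≡ reverse ys ++ b ∷ a ∷ []
  reversed = begin
    reverse (a ∷ b ∷ ys)             ≡⟨ unfold-reverse a (b ∷ ys) ⟩
    reverse (b ∷ ys) ++ [ a ]        ≡⟨ cong (_++ [ a ]) (unfold-reverse b ys) ⟩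
    (reverse ys ++ [ b ]) ++ [ a ]   ≡⟨ ++-assoc (reverse ys) [ b ] [ a ] ⟩
    reverse ys ++ b ∷ a ∷ []         ∎
  lengths : length (reverse ys) ≡ length (reverse rs)
  lengths = trans (length-reverse ys) (trans (suc-injective (suc-injective len)) (sym (length-reverse rs)))

satisfiesᵒᵖᵇ-opposite : ∀ {m} rs (l : List (Fin m)) →
  satisfiesᵒᵖᵇ rs (map (toℕ ∘ opposite) l) ≡ satisfiesᵇ rs (map toℕ l)
satisfiesᵒᵖᵇ-opposite []       l           = refl
satisfiesᵒᵖᵇ-opposite (r ∷ rs) []          = refl
satisfiesᵒᵖᵇ-opposite (r ∷ rs) (a ∷ [])    = refl
satisfiesᵒᵖᵇ-opposite (r ∷ rs) (a ∷ b ∷ l) = cong₂ _∧_ (stepᵇ-opposite r a b) (satisfiesᵒᵖᵇ-opposite rs (b ∷ l))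

countᵇ-reverse : (P : A → Bool) (xs : List A) → countᵇ P (reverse xs) ≡ countᵇ P xs
countᵇ-reverse P []       = refl
countᵇ-reverse P (x ∷ xs) = begin
  countᵇ P (reverse (x ∷ xs))        ≡⟨ cong (countᵇ P) (unfold-reverse x xs) ⟩
  countᵇ P (reverse xs ++ [ x ])     ≡⟨ countᵇ-++ P (reverse xs) [ x ] ⟩
  countᵇ P (reverse xs) + countᵇ P [ x ] ≡⟨ cong₂ _+_ (countᵇ-reverse P xs) (+-identityʳ _) ⟩
  countᵇ P xs + (if P x then 1 else 0)   ≡⟨ +-comm (countᵇ P xs) _ ⟩
  countᵇ P (x ∷ xs)                  ∎

multiplicity-opposite : ∀ {m} (i : Fin m) l → multiplicity i (map opposite l) ≡ multiplicity (opposite i) l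
multiplicity-opposite i l =
  trans (countᵇ-map _ opposite l) (countᵇ-cong l (λ x → ≡ᵇ-opposite x i))

reflectReverse : ∀ {m} → List (Fin m) → List (Fin m)
reflectReverse = reverse ∘ map opposite

reflectReverse-involutive : ∀ {m} (l : List (Fin m)) → reflectReverse (reflectReverse l) ≡ l
reflectReverse-involutive l = begin
  reverse (map opposite (reverse (map opposite l))) ≡⟨ cong reverse (reverse-map opposite (map opposite l)) ⟩
  reverse (reverse (map opposite (map opposite l))) ≡⟨ reverse-involutive _ ⟩
  map opposite (map opposite l)                    ≡⟨ map-∘ l ⟨
  map (opposite ∘ opposite) l                      ≡⟨ map-cong opposite-involutive l ⟩
  map (λ x → x) l                                  ≡⟨ map-id l ⟩
  l                                                ∎

length-reflectReverse : ∀ {m} (l : List (Fin m)) → length (reflectReverse l) ≡ length l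
length-reflectReverse l = trans (length-reverse (map opposite l)) (length-map opposite l)

satisfiesᵇ-reflectReverse : ∀ {m} rs (l : List (Fin m)) → length l ≡ suc (length rs) →
  satisfiesᵇ rs (map toℕ (reflectReverse l)) ≡ satisfiesᵇ (reverse rs) (map toℕ l)
satisfiesᵇ-reflectReverse rs l len = begin
  satisfiesᵇ rs (map toℕ (reverse (map opposite l)))
    ≡⟨ cong (satisfiesᵇ rs) (trans (reverse-map toℕ (map opposite l)) (cong reverse (sym (map-∘ l)))) ⟩
  satisfiesᵇ rs (reverse (map (toℕ ∘ opposite) l))
    ≡⟨ cong (λ rs′ → satisfiesᵇ rs′ (reverse (map (toℕ ∘ opposite) l))) (reverse-involutive rs) ⟨
  satisfiesᵇ (reverse (reverse rs)) (reverse (map (toℕ ∘ opposite) l))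
    ≡⟨ satisfiesᵇ-reverse (reverse rs) (map (toℕ ∘ opposite) l)
         (trans (length-map _ l) (trans len (cong suc (sym (length-reverse rs))))) ⟩
  satisfiesᵒᵖᵇ (reverse rs) (map (toℕ ∘ opposite) l)
    ≡⟨ satisfiesᵒᵖᵇ-opposite (reverse rs) l ⟩
  satisfiesᵇ (reverse rs) (map toℕ l) ∎

content-reflectReverse : ∀ {m} (l : List (Fin m)) → content (reflectReverse l) ≡ reverseVars (content l)
content-reflectReverse l = tabulate-cong λ i → begin
  multiplicity i (reverse (map opposite l)) ≡⟨ countᵇ-reverse _ (map opposite l) ⟩
  multiplicity i (map opposite l)           ≡⟨ multiplicity-opposite i l ⟩
  multiplicity (opposite i) l               ≡⟨ lookup∘tabulate _ (opposite i) ⟨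
  lookup (content l) (opposite i)           ∎

vecEqᵇ-content-reflectReverse : ∀ {m} (l : List (Fin m)) e →
  vecEqᵇ (content (reflectReverse l)) (reverseVars e) ≡ vecEqᵇ (content l) e
vecEqᵇ-content-reflectReverse l e = begin
  vecEqᵇ (content (reflectReverse l)) (reverseVars e)
    ≡⟨ cong (λ c → vecEqᵇ c (reverseVars e)) (content-reflectReverse l) ⟩
  vecEqᵇ (reverseVars (content l)) (reverseVars e)
    ≡⟨ vecEqᵇ-reverseVars (content l) (reverseVars e) ⟩
  vecEqᵇ (content l) (reverseVars (reverseVars e))
    ≡⟨ cong (vecEqᵇ (content l)) (reverseVars-involutive e) ⟩
  vecEqᵇ (content l) e ∎

wordCount-reverse : ∀ rs m e →
  wordCount (reverse rs) (suc (length rs)) m e ≡ wordCount rs (suc (length rs)) m (reverseVars e)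
wordCount-reverse rs m e =
  countᵇ-bijection (allLists-unique n m) (allLists-unique n m) P Q reflectReverse reflectReverse
    (λ {l} l∈ t → let len = ∈-allLists⁻ l∈ in
       ∈-allLists⁺ _ (trans (length-reflectReverse l) len) , subst T (sym (Q∘reflectReverse l len)) t ,
       reflectReverse-involutive l)
    (λ {l} l∈ t → let len = ∈-allLists⁻ l∈ ; len′ = trans (length-reflectReverse l) len in
       ∈-allLists⁺ _ len′ ,
       subst T (trans (cong Q (sym (reflectReverse-involutive l))) (Q∘reflectReverse (reflectReverse l) len′)) t ,
       reflectReverse-involutive l)
  where
  n : ℕ
  n = suc (length rs)
  P Q : List (Fin m) → Bool
  P l = satisfiesᵇ (reverse rs) (map toℕ l) ∧ vecEqᵇ (content l) e
  Q l = satisfiesᵇ rs (map toℕ l) ∧ vecEqᵇ (content l) (reverseVars e)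
  Q∘reflectReverse : ∀ l → length l ≡ n → Q (reflectReverse l) ≡ P l
  Q∘reflectReverse l len =
    cong₂ _∧_ (satisfiesᵇ-reflectReverse rs l len) (vecEqᵇ-content-reflectReverse l e)

F-reverse : ∀ rs m e → EqualityFree rs → F (reverse (runs rs)) m e ≡ F (runs rs) m (reverseVars e)
F-reverse rs m e ne = begin
  F (reverse (runs rs)) m e                         ≡⟨ cong (λ α → F α m e) (reverse-runs rs) ⟩
  F (runs (reverse rs)) m e                         ≡⟨ F-runs (reverse rs) m e (reverse-equalityFree ne) ⟩
  + wordCount (reverse rs) (suc (length (reverse rs))) m e
    ≡⟨ cong (λ n → + wordCount (reverse rs) (suc n) m e) (length-reverse rs) ⟩
  + wordCount (reverse rs) (suc (length rs)) m e    ≡⟨ cong +_ (wordCount-reverse rs m e) ⟩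
  + wordCount rs (suc (length rs)) m (reverseVars e) ≡⟨ F-runs rs m (reverseVars e) ne ⟨
  F (runs rs) m (reverseVars e)                     ∎

-- The F-expansion of K

-- A weight w(u) ≥ 1 contributes w(u) ∸ 1 extra copies of its variable.
excess : ∀ {k} → (Fin k → ℕ) → List ℕ
excess w = List.tabulate (λ u → w u ∸ 1)

partitionWord : ∀ k → (ℕ → ℕ → Bool) → (γ w : Fin k → ℕ) → List Step
partitionWord k c γ w = blockWord (excess w) (chainWord c (List.tabulate γ))

chainWord-aligned : ∀ k c (f γ : Fin k → ℕ) → Aligned (List.tabulate f) (chainWord c (List.tabulate γ))
chainWord-aligned zero          c f γ = tt
chainWord-aligned (suc zero)    c f γ = tt
chainWord-aligned (suc (suc k)) c f γ = chainWord-aligned (suc k) c (f ∘ fsuc) (γ ∘ fsuc)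

chainWord-equalityFree : ∀ c gs → EqualityFree (chainWord c gs)
chainWord-equalityFree c []           = []
chainWord-equalityFree c (g ∷ [])     = []
chainWord-equalityFree c (g ∷ h ∷ gs) = labelStep≢equal (c g h) ∷ chainWord-equalityFree c (h ∷ gs)
  where
  labelStep≢equal : ∀ b → labelStep b ≢ equal
  labelStep≢equal true  ()
  labelStep≢equal false ()

equalCount-++ : ∀ R R′ → equalCount (R ++ R′) ≡ equalCount R + equalCount R′
equalCount-++ []           R′ = refl
equalCount-++ (weak ∷ R)   R′ = equalCount-++ R R′
equalCount-++ (strict ∷ R) R′ = equalCount-++ R R′
equalCount-++ (equal ∷ R)  R′ = cong suc (equalCount-++ R R′)

equalCount-replicate : ∀ w → equalCount (replicate w equal) ≡ w
equalCount-replicate zero    = refl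
equalCount-replicate (suc w) = cong suc (equalCount-replicate w)

equalCount-blockWord : ∀ ws bs → Aligned ws bs → EqualityFree bs → equalCount (blockWord ws bs) ≡ sumL ws
equalCount-tailWord  : ∀ w ws bs → Aligned (w ∷ ws) bs → EqualityFree bs → equalCount (tailWord ws bs) ≡ sumL ws
equalCount-blockWord []       bs aligned ne = refl
equalCount-blockWord (w ∷ ws) bs aligned ne = trans (equalCount-++ (replicate w equal) _)
  (cong₂ _+_ (equalCount-replicate w) (equalCount-tailWord w ws bs aligned ne))
equalCount-tailWord w []        bs             aligned ne        = refl
equalCount-tailWord w (w′ ∷ ws) (weak ∷ bs)    aligned (_ ∷ ne)  = equalCount-blockWord (w′ ∷ ws) bs aligned ne
equalCount-tailWord w (w′ ∷ ws) (strict ∷ bs)  aligned (_ ∷ ne)  = equalCount-blockWord (w′ ∷ ws) bs aligned ne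
equalCount-tailWord w (w′ ∷ ws) (equal ∷ bs)   aligned (b≢ ∷ _)  = ⊥-elim (b≢ refl)

length-blockWord : ∀ w ws bs → Aligned (w ∷ ws) bs →
  suc (length (blockWord (w ∷ ws) bs)) ≡ length (w ∷ ws) + sumL (w ∷ ws)
length-tailWord  : ∀ w ws bs → Aligned (w ∷ ws) bs → length (tailWord ws bs) ≡ length ws + sumL ws
length-blockWord w ws bs aligned = cong suc (begin
  length (replicate w equal ++ tailWord ws bs)          ≡⟨ length-++ (replicate w equal) ⟩
  length (replicate w equal) + length (tailWord ws bs)  ≡⟨ cong₂ _+_ (length-replicate w) (length-tailWord w ws bs aligned) ⟩
  w + (length ws + sumL ws)                             ≡⟨ blockLength w ws ⟨
  length ws + (w + sumL ws)                             ∎)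
length-tailWord w []        bs       aligned = refl
length-tailWord w (w′ ∷ ws) (b ∷ bs) aligned = length-blockWord w′ ws bs aligned

blockWord-flipStep : ∀ ws bs → blockWord ws (map flipStep bs) ≡ map flipStep (blockWord ws bs)
tailWord-flipStep  : ∀ ws bs → tailWord ws (map flipStep bs) ≡ map flipStep (tailWord ws bs)
blockWord-flipStep []       bs = refl
blockWord-flipStep (w ∷ ws) bs = begin
  replicate w equal ++ tailWord ws (map flipStep bs)              ≡⟨ cong (replicate w equal ++_) (tailWord-flipStep ws bs) ⟩
  replicate w equal ++ map flipStep (tailWord ws bs)              ≡⟨ cong (_++ map flipStep (tailWord ws bs)) (map-replicate flipStep w equal) ⟨
  map flipStep (replicate w equal) ++ map flipStep (tailWord ws bs) ≡⟨ map-++ flipStep (replicate w equal) _ ⟨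
  map flipStep (replicate w equal ++ tailWord ws bs)              ∎
tailWord-flipStep []       bs       = refl
tailWord-flipStep (w ∷ ws) []       = refl
tailWord-flipStep (w ∷ ws) (b ∷ bs) = cong (flipStep b ∷_) (blockWord-flipStep (w ∷ ws) bs)

labelStep-dual : ∀ a b → a ≢ b → labelStep (dualᵇ labelLt a b) ≡ flipStep (labelStep (labelLt a b))
labelStep-dual a b a≢b with a <ᵇ b in a<ᵇb | b <ᵇ a in b<ᵇa
... | true  | true  = ⊥-elim (<-asym (<ᵇ⇒< a b (subst T (sym a<ᵇb) tt)) (<ᵇ⇒< b a (subst T (sym b<ᵇa) tt)))
... | true  | false = refl
... | false | true  = refl
... | false | false = ⊥-elim (a≢b (≤-antisym (≮⇒≥ (λ b<a → subst T b<ᵇa (<⇒<ᵇ b<a)))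
                                            (≮⇒≥ (λ a<b → subst T a<ᵇb (<⇒<ᵇ a<b)))))

chainWord-dual : ∀ k (γ : Fin k → ℕ) → Injective _≡_ _≡_ γ →
  chainWord (dualᵇ labelLt) (List.tabulate γ) ≡ map flipStep (chainWord labelLt (List.tabulate γ))
chainWord-dual zero          γ γ-inj = refl
chainWord-dual (suc zero)    γ γ-inj = refl
chainWord-dual (suc (suc k)) γ γ-inj =
  cong₂ _∷_ (labelStep-dual (γ fzero) (γ (fsuc fzero)) (λ γ0≡γ1 → 0≢1 (γ-inj γ0≡γ1)))
            (chainWord-dual (suc k) (γ ∘ fsuc) (λ e → fsuc-injective (γ-inj e)))
  where
  0≢1 : fzero ≢ fsuc {suc k} fzero
  0≢1 ()
  fsuc-injective : ∀ {x y : Fin (suc k)} → fsuc x ≡ fsuc y → x ≡ y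
  fsuc-injective refl = refl

labelLt-trans : Transitiveᵇ labelLt
labelLt-trans a b c a<b b<c = <⇒<ᵇ (<-trans (<ᵇ⇒< a b a<b) (<ᵇ⇒< b c b<c))

dual-labelLt-trans : Transitiveᵇ (dualᵇ labelLt)
dual-labelLt-trans a b c a>b b>c = labelLt-trans c b a b>c a>b

tabulate≡map-suc-excess : ∀ {k} (w : Fin k → ℕ) → (∀ u → 1 ≤ w u) → List.tabulate w ≡ map suc (excess w)
tabulate≡map-suc-excess w w≥1 =
  trans (Listₚ.tabulate-cong (λ u → suc-∸1 (w≥1 u))) (sym (map-tabulate (λ u → w u ∸ 1) suc))
  where
  suc-∸1 : ∀ {x} → 1 ≤ x → x ≡ suc (x ∸ 1)
  suc-∸1 {suc x} _ = refl

sumL-map-suc : ∀ ws → sumL (map suc ws) ≡ length ws + sumL ws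
sumL-map-suc []       = refl
sumL-map-suc (w ∷ ws) = cong suc (trans (cong (λ s → w + s) (sumL-map-suc ws)) (sym (blockLength w ws)))

sumFin≡length+excess : ∀ k (w : Fin k → ℕ) → (∀ u → 1 ≤ w u) → sumFin k w ≡ k + sumL (excess w)
sumFin≡length+excess k w w≥1 = begin
  sumL (map w (allFin k))              ≡⟨ cong sumL (map-tabulate (λ u → u) w) ⟩
  sumL (List.tabulate w)               ≡⟨ cong sumL (tabulate≡map-suc-excess w w≥1) ⟩
  sumL (map suc (excess w))            ≡⟨ sumL-map-suc (excess w) ⟩
  length (excess w) + sumL (excess w)  ≡⟨ cong (_+ sumL (excess w)) (Listₚ.length-tabulate (λ u → w u ∸ 1)) ⟩
  k + sumL (excess w)                  ∎

equalCount-partitionWord : ∀ k c (γ w : Fin k → ℕ) → (∀ u → 1 ≤ w u) →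
  equalCount (partitionWord k c γ w) ≡ sumFin k w ∸ k
equalCount-partitionWord k c γ w w≥1 = begin
  equalCount (partitionWord k c γ w)
    ≡⟨ equalCount-blockWord (excess w) _ (chainWord-aligned k c (λ u → w u ∸ 1) γ) (chainWord-equalityFree c _) ⟩
  sumL (excess w)                    ≡⟨ m+n∸m≡n k _ ⟨
  k + sumL (excess w) ∸ k            ≡⟨ cong (_∸ k) (sumFin≡length+excess k w w≥1) ⟨
  sumFin k w ∸ k                     ∎

partitionWord-dual : ∀ k (γ w : Fin k → ℕ) → Injective _≡_ _≡_ γ →
  map flipStep (partitionWord k labelLt γ w) ≡ partitionWord k (dualᵇ labelLt) γ w
partitionWord-dual k γ w γ-inj = begin
  map flipStep (blockWord (excess w) (chainWord labelLt (List.tabulate γ)))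
    ≡⟨ blockWord-flipStep (excess w) _ ⟨
  blockWord (excess w) (map flipStep (chainWord labelLt (List.tabulate γ)))
    ≡⟨ cong (blockWord (excess w)) (chainWord-dual k γ γ-inj) ⟨
  blockWord (excess w) (chainWord (dualᵇ labelLt) (List.tabulate γ)) ∎

K-resolve : ∀ k c → Transitiveᵇ c → (γ w : Fin (suc k) → ℕ) → (∀ u → 1 ≤ w u) → ∀ m e →
  K (suc k) chainLt c γ w m e ≡ resolve (λ rs → F (runs rs) m e) (partitionWord (suc k) c γ w)
K-resolve k c c-trans γ w w≥1 m e = begin
  K (suc k) chainLt c γ w m e
    ≡⟨ K-chain (suc k) c c-trans γ w m e ⟩
  + weightedWordCount bs (List.tabulate w) (suc k) m e
    ≡⟨ cong₂ (λ W n → + weightedWordCount bs W n m e) (tabulate≡map-suc-excess w w≥1) (sym (Listₚ.length-tabulate (λ u → w u ∸ 1))) ⟩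
  + weightedWordCount bs (map suc ws) (length ws) m e
    ≡⟨ cong +_ (weightedWordCount-expand ws bs e (chainWord-aligned (suc k) c (λ u → w u ∸ 1) γ)) ⟩
  + wordCount R (length ws + sumL ws) m e
    ≡⟨ cong (λ n → + wordCount R n m e)
            (sym (length-blockWord (w fzero ∸ 1) (excess (w ∘ fsuc)) bs (chainWord-aligned (suc k) c (λ u → w u ∸ 1) γ))) ⟩
  + wordCount R (suc (length R)) m e
    ≡⟨ wordCount-resolve R m e ⟩
  resolve (λ rs → + wordCount rs (suc (length R)) m e) R
    ≡⟨ resolve-cong R (λ rs ne len → trans (cong (λ n → + wordCount rs (suc n) m e) (sym len)) (sym (F-runs rs m e ne))) ⟩
  resolve (λ rs → F (runs rs) m e) R ∎
  where
  ws : List ℕ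
  ws = excess w
  bs R : List Step
  bs = chainWord c (List.tabulate γ)
  R = partitionWord (suc k) c γ w

toCompositions : List (ℤ × List Step) → List (ℤ × List ℕ)
toCompositions = map (λ (c , rs) → c , runs rs)

toCompositions-compositions : ∀ L → All (IsComposition ∘ proj₂) (toCompositions L)
toCompositions-compositions []             = []
toCompositions-compositions ((c , rs) ∷ L) = runs-composition rs ∷ toCompositions-compositions L

linF-toCompositions : ∀ L m e → linF (toCompositions L) m e ≡ signedSum (λ rs → F (runs rs) m e) L
linF-toCompositions []             m e = refl
linF-toCompositions ((c , rs) ∷ L) m e = cong (c *ℤ F (runs rs) m e +ℤ_) (linF-toCompositions L m e)

linF-onBasis : ∀ φ L m e → linF (onBasis φ (toCompositions L)) m e ≡ signedSum (λ rs → F (φ (runs rs)) m e) L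
linF-onBasis φ []             m e = refl
linF-onBasis φ ((c , rs) ∷ L) m e = cong (c *ℤ F (φ (runs rs)) m e +ℤ_) (linF-onBasis φ L m e)

mapsTo-resolve : ∀ φ R {A B : Series} →
  (∀ m e → A m e ≡ resolve (λ rs → F (runs rs) m e) R) →
  (∀ m e → B m e ≡ resolve (λ rs → F (φ (runs rs)) m e) R) → MapsTo φ A B
mapsTo-resolve φ R A≡ B≡ =
  toCompositions (resolution R) , toCompositions-compositions (resolution R) ,
  (λ m e → trans (A≡ m e) (sym (trans (linF-toCompositions (resolution R) m e) (signedSum-resolution R _)))) ,
  (λ m e → trans (B≡ m e) (sym (trans (linF-onBasis φ (resolution R) m e) (signedSum-resolution R _))))

F-tC-runs : ∀ rs m e → EqualityFree rs → F (tC (runs rs)) m e ≡ F (cC (runs rs)) m (reverseVars e)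
F-tC-runs rs m e ne = begin
  F (cC (reverse (runs rs))) m e          ≡⟨ cong (λ α → F (cC α) m e) (reverse-runs rs) ⟩
  F (cC (runs (reverse rs))) m e          ≡⟨ cong (λ α → F α m e) (cC-runs (reverse rs) (reverse-equalityFree ne)) ⟩
  F (runs (map flipStep (reverse rs))) m e ≡⟨ cong (λ rs′ → F (runs rs′) m e) (reverse-map flipStep rs) ⟩
  F (runs (reverse (map flipStep rs))) m e ≡⟨ cong (λ α → F α m e) (reverse-runs (map flipStep rs)) ⟨
  F (reverse (runs (map flipStep rs))) m e ≡⟨ F-reverse (map flipStep rs) m e (flipStep-equalityFree ne) ⟩
  F (runs (map flipStep rs)) m (reverseVars e) ≡⟨ cong (λ α → F α m (reverseVars e)) (cC-runs rs ne) ⟨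
  F (cC (runs rs)) m (reverseVars e)      ∎

ψ-resolve : ∀ k (γ w : Fin (suc k) → ℕ) → Injective _≡_ _≡_ γ → (∀ u → 1 ≤ w u) → ∀ m e →
  sign (sumFin (suc k) w ∸ suc k) *ℤ K (suc k) chainLt (dualᵇ labelLt) γ w m e
  ≡ resolve (λ rs → F (cC (runs rs)) m e) (partitionWord (suc k) labelLt γ w)
ψ-resolve k γ w γ-inj w≥1 m e = sym (begin
  resolve (λ rs → F (cC (runs rs)) m e) R
    ≡⟨ resolve-cong R (λ rs ne _ → cong (λ α → F α m e) (cC-runs rs ne)) ⟩
  resolve (λ rs → F (runs (map flipStep rs)) m e) R
    ≡⟨ resolve-flipStep R (λ rs → F (runs rs) m e) ⟩
  sign (equalCount R) *ℤ resolve (λ rs → F (runs rs) m e) (map flipStep R)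
    ≡⟨ cong₂ (λ n R′ → sign n *ℤ resolve (λ rs → F (runs rs) m e) R′)
             (equalCount-partitionWord (suc k) labelLt γ w w≥1) (partitionWord-dual (suc k) γ w γ-inj) ⟩
  sign (sumFin (suc k) w ∸ suc k) *ℤ resolve (λ rs → F (runs rs) m e) (partitionWord (suc k) (dualᵇ labelLt) γ w)
    ≡⟨ cong (sign (sumFin (suc k) w ∸ suc k) *ℤ_) (K-resolve k (dualᵇ labelLt) dual-labelLt-trans γ w w≥1 m e) ⟨
  sign (sumFin (suc k) w ∸ suc k) *ℤ K (suc k) chainLt (dualᵇ labelLt) γ w m e ∎)
  where
  R : List Step
  R = partitionWord (suc k) labelLt γ w

ρ-resolve : ∀ k (γ w : Fin (suc k) → ℕ) → (∀ u → 1 ≤ w u) → ∀ m e →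
  K (suc k) (dualᵇ chainLt) (dualᵇ labelLt) γ w m e
  ≡ resolve (λ rs → F (revC (runs rs)) m e) (partitionWord (suc k) labelLt γ w)
ρ-resolve k γ w w≥1 m e = begin
  K (suc k) (dualᵇ chainLt) (dualᵇ labelLt) γ w m e
    ≡⟨ K-dualChain (suc k) (dualᵇ labelLt) γ w m e ⟩
  K (suc k) chainLt labelLt γ w m (reverseVars e)
    ≡⟨ K-resolve k labelLt labelLt-trans γ w w≥1 m (reverseVars e) ⟩
  resolve (λ rs → F (runs rs) m (reverseVars e)) R
    ≡⟨ resolve-cong R (λ rs ne _ → sym (F-reverse rs m e ne)) ⟩
  resolve (λ rs → F (revC (runs rs)) m e) R ∎
  where
  R : List Step
  R = partitionWord (suc k) labelLt γ w

ω-resolve : ∀ k (γ w : Fin (suc k) → ℕ) → Injective _≡_ _≡_ γ → (∀ u → 1 ≤ w u) → ∀ m e →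
  sign (sumFin (suc k) w ∸ suc k) *ℤ K (suc k) (dualᵇ chainLt) labelLt γ w m e
  ≡ resolve (λ rs → F (tC (runs rs)) m e) (partitionWord (suc k) labelLt γ w)
ω-resolve k γ w γ-inj w≥1 m e = begin
  sign (sumFin (suc k) w ∸ suc k) *ℤ K (suc k) (dualᵇ chainLt) labelLt γ w m e
    ≡⟨ cong (sign (sumFin (suc k) w ∸ suc k) *ℤ_) (K-dualChain (suc k) labelLt γ w m e) ⟩
  sign (sumFin (suc k) w ∸ suc k) *ℤ K (suc k) chainLt (dualᵇ labelLt) γ w m (reverseVars e)
    ≡⟨ ψ-resolve k γ w γ-inj w≥1 m (reverseVars e) ⟩
  resolve (λ rs → F (cC (runs rs)) m (reverseVars e)) R
    ≡⟨ resolve-cong R (λ rs ne _ → sym (F-tC-runs rs m e ne)) ⟩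
  resolve (λ rs → F (tC (runs rs)) m e) R ∎
  where
  R : List Step
  R = partitionWord (suc k) labelLt γ w

-- The empty chain has K = 1 = F_∅, and F_∅ is fixed by ψ, ρ and ω.
mapsTo-emptyChain : ∀ φ → φ [] ≡ [] → ∀ {A B : Series} →
  (∀ m e → A m e ≡ F [] m e) → (∀ m e → B m e ≡ F [] m e) → MapsTo φ A B
mapsTo-emptyChain φ φ[]≡[] A≡ B≡ = (1ℤ , []) ∷ [] , [] ∷ [] ,
  (λ m e → trans (A≡ m e) (oneTerm [] {m} {e}))
  , λ m e → trans (B≡ m e) (trans (oneTerm [] {m} {e}) (cong (λ α → 1ℤ *ℤ F α m e +ℤ 0ℤ) (sym φ[]≡[])))
  where
  oneTerm : ∀ α {m e} → F α m e ≡ 1ℤ *ℤ F α m e +ℤ 0ℤ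
  oneTerm α {m} {e} = sym (trans (ℤ.+-identityʳ (1ℤ *ℤ F α m e)) (ℤ.*-identityˡ (F α m e)))

lemma3p7 : (k : ℕ) (γ : Fin k → ℕ) → Injective _≡_ _≡_ γ
    → (w : Fin k → ℕ) → (∀ u → 1 ≤ w u)
    → ψ-maps (K k chainLt labelLt γ w)
        (scale (sign (sumFin k w ∸ k)) (K k chainLt (dualᵇ labelLt) γ w))
      × ρ-maps (K k chainLt labelLt γ w)
        (K k (dualᵇ chainLt) (dualᵇ labelLt) γ w)
      × ω-maps (K k chainLt labelLt γ w)
        (scale (sign (sumFin k w ∸ k)) (K k (dualᵇ chainLt) labelLt γ w))
lemma3p7 zero γ γ-inj w w≥1 =
    mapsTo-emptyChain cC refl (λ _ _ → refl) (λ m e → ℤ.*-identityˡ (K 0 chainLt (dualᵇ labelLt) γ w m e))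
  , mapsTo-emptyChain revC refl (λ _ _ → refl) (λ _ _ → refl)
  , mapsTo-emptyChain tC refl (λ _ _ → refl) (λ m e → ℤ.*-identityˡ (K 0 (dualᵇ chainLt) labelLt γ w m e))
lemma3p7 (suc k) γ γ-inj w w≥1 =
    mapsTo-resolve cC R K≡resolve (ψ-resolve k γ w γ-inj w≥1)
  , mapsTo-resolve revC R K≡resolve (ρ-resolve k γ w w≥1)
  , mapsTo-resolve tC R K≡resolve (ω-resolve k γ w γ-inj w≥1)
  where
  R : List Step
  R = partitionWord (suc k) labelLt γ w
  K≡resolve : ∀ m e → K (suc k) chainLt labelLt γ w m e ≡ resolve (λ rs → F (runs rs) m e) R
  K≡resolve = K-resolve k labelLt labelLt-trans γ w w≥1
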